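{- Let $n\ge 3$, let $F$ be a set of faulty edges of $Q_n$, and let $T$ be a proper subset of the vertex set of $Q_n$ with $|T|\ge 3$, such that $|T|_0\ge |T|_1$ and every edge joining a vertex of parity 0 in $T$ with a vertex outside $T$ belongs to $F$. Then: (1) If there are two vertices $u,v\in T$ with $(u,v)\in F$, then $F$ is not minimal. (2) If $|T|_0>|T|_1$, then $F$ is not minimal. (3) If the subgraph induced by $T$ is not connected, then $F$ is not minimal. (4) If the subgraph induced by $T$ has a pendant vertex (a vertex of degree 1 in it), then either $F$ is not minimal or there is a proper subset $T'\subsetneq T$ which is disconnected halfway with respect to the same set of faulty edges $F$. (5) Suppose that $T$ can be partitioned into two connected subsets $T_1,T_2$, each with equally many vertices of parity 0 and of parity 1, and that there are vertices $v_1\in T_1$, $v_2\in T_2$ such that $(v_1,v_2)$ is an edge and every path in $T$ from $v_1$ to $v_2$ contains the edge $(v_1,v_2)$. Then $F$ is not minimal.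
   Context: $Q_n$ is the $n$-dimensional hypercube: vertices are binary strings of length $n$, adjacent iff they differ in exactly one bit. The parity of a vertex is the parity of the number of ones in its label; $Q_n$ is bipartite with respect to parity. A set of vertices is identified with the subgraph of $Q_n$ it induces. For a vertex set $T$, $|T|_0$ and $|T|_1$ denote the numbers of vertices of $T$ of parity 0 and parity 1. Given a set $F$ of faulty edges, $Q_n$ with faulty edges $F$ means the graph $Q_n-F$; it is Hamiltonian if $Q_n-F$ has a Hamiltonian cycle. $F$ is minimal if no proper subset of $F$ precludes Hamiltonian cycles, i.e. $Q_n-F'$ is Hamiltonian for every proper subset $F'\subsetneq F$. A proper subset $T$ of the vertices is disconnected halfway (with respect to $F$) if either (a) $|T|_0\ge|T|_1$ and all edges joining parity-0 vertices of $T$ with vertices outside $T$ are in $F$, or (b) $|T|_1\ge|T|_0$ and all edges joining parity-1 vertices of $T$ with vertices outside $T$ are in $F$. -}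

module Defs where

open import Data.Bool using (Bool; true; false; not; _∧_; _∨_; if_then_else_)
open import Data.Bool.Properties using () renaming (_≟_ to _≟B_)
open import Data.Nat using (ℕ; zero; suc; _+_; _≤_; _<_; _≥_)
open import Data.Fin using (Fin)
open import Data.List using (List; []; _∷_; _++_; [_]; map; filter; length; allFin)
open import Data.List.Relation.Unary.Unique.Propositional using (Unique)
open import Data.List.Relation.Unary.Linked using (Linked)
open import Data.List.Membership.Propositional using (_∈_)
open import Data.Vec using (Vec; []; _∷_; lookup; updateAt; _[_]≔_)
open import Data.Vec.Properties using (lookup∘update)
open import Data.Product using (Σ; Σ-syntax; ∃; ∃-syntax; _×_; _,_)
open import Relation.Binary.PropositionalEquality using (_≡_; _≢_)
open import Relation.Binary.Construct.Closure.ReflexiveTransitive using (Star)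
open import Relation.Nullary using (¬_)

Vertex : ℕ → Set
Vertex n = Vec Bool n

flip : ∀ {n} → Vertex n → Fin n → Vertex n
flip u i = updateAt u i not

Adjacent : ∀ {n} → Vertex n → Vertex n → Set
Adjacent {n} u v = Σ[ i ∈ Fin n ] v ≡ flip u i

allVertices : (n : ℕ) → List (Vertex n)
allVertices zero    = [] ∷ []
allVertices (suc n) = map (false ∷_) (allVertices n) ++ map (true ∷_) (allVertices n)

-- parity of a vertex: false = even (parity 0), true = odd (parity 1)
parity : ∀ {n} → Vertex n → Bool
parity []           = false
parity (false ∷ xs) = parity xs
parity (true ∷ xs)  = not (parity xs)

-- an edge of Q_n, represented canonically by its endpoint with bit i = 0
-- and its direction i; the other endpoint is  flip v i
Edge : ℕ → Set
Edge n = Σ[ v ∈ Vertex n ] Σ[ i ∈ Fin n ] lookup v i ≡ false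

edgeAt : ∀ {n} → Vertex n → Fin n → Edge n
edgeAt u i = (u [ i ]≔ false) , i , lookup∘update i u false

EdgeSet : ℕ → Set
EdgeSet n = Edge n → Bool

_∈E_ : ∀ {n} → Edge n → EdgeSet n → Set
e ∈E F = F e ≡ true

_∉E_ : ∀ {n} → Edge n → EdgeSet n → Set
e ∉E F = F e ≡ false

_⊆E_ : ∀ {n} → EdgeSet n → EdgeSet n → Set
F' ⊆E F = ∀ e → e ∈E F' → e ∈E F

_⊊E_ : ∀ {n} → EdgeSet n → EdgeSet n → Set
F' ⊊E F = F' ⊆E F × (∃[ e ] (e ∈E F × e ∉E F'))

Link : ∀ {n} → EdgeSet n → Vertex n → Vertex n → Set
Link {n} F u v = Σ[ i ∈ Fin n ] (v ≡ flip u i × edgeAt u i ∉E F)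

HamiltonianCycle : ∀ {n} → EdgeSet n → Vertex n → List (Vertex n) → Set
HamiltonianCycle F x xs =
  Unique (x ∷ xs) × (∀ v → v ∈ (x ∷ xs)) × Linked (Link F) ((x ∷ xs) ++ [ x ])

Hamiltonian : ∀ {n} → EdgeSet n → Set
Hamiltonian {n} F = Σ[ x ∈ Vertex n ] Σ[ xs ∈ List (Vertex n) ] HamiltonianCycle F x xs

Minimal : ∀ {n} → EdgeSet n → Set
Minimal {n} F = (F' : EdgeSet n) → F' ⊊E F → Hamiltonian F'

VSet : ℕ → Set
VSet n = Vertex n → Bool

_∈V_ : ∀ {n} → Vertex n → VSet n → Set
v ∈V T = T v ≡ true

_∉V_ : ∀ {n} → Vertex n → VSet n → Set
v ∉V T = T v ≡ false

_⊆V_ : ∀ {n} → VSet n → VSet n → Set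
S ⊆V T = ∀ v → v ∈V S → v ∈V T

_⊊V_ : ∀ {n} → VSet n → VSet n → Set
S ⊊V T = S ⊆V T × (∃[ v ] (v ∈V T × v ∉V S))

ProperVSet : ∀ {n} → VSet n → Set
ProperVSet T = ∃[ v ] v ∉V T

size : ∀ {n} → VSet n → ℕ
size {n} T = length (filter (λ v → T v ≟B true) (allVertices n))

-- |T|_b  (number of vertices of T of parity b; b = false is parity 0)
sizeP : ∀ {n} → Bool → VSet n → ℕ
sizeP {n} b T = length (filter (λ v → (T v ∧ (if parity v then b else not b)) ≟B true) (allVertices n))

size₀ size₁ : ∀ {n} → VSet n → ℕ
size₀ = sizeP false
size₁ = sizeP true

CutAt : ∀ {n} → Bool → EdgeSet n → VSet n → Set
CutAt b F T = ∀ u i → u ∈V T → parity u ≡ b → flip u i ∉V T → edgeAt u i ∈E F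

DisconnectedHalfway : ∀ {n} → EdgeSet n → VSet n → Set
DisconnectedHalfway F T =
  (∃[ v ] v ∈V T) × ProperVSet T ×
  ((size₀ T ≥ size₁ T × CutAt false F T) ⊎' (size₁ T ≥ size₀ T × CutAt true F T))
  where
  open import Data.Sum using () renaming (_⊎_ to _⊎'_)

AdjIn : ∀ {n} → VSet n → Vertex n → Vertex n → Set
AdjIn T u v = u ∈V T × v ∈V T × Adjacent u v

Connected : ∀ {n} → VSet n → Set
Connected T = ∀ u v → u ∈V T → v ∈V T → Star (AdjIn T) u v

degreeIn : ∀ {n} → VSet n → Vertex n → ℕ
degreeIn {n} T v = length (filter (λ i → T (flip v i) ≟B true) (allFin n))

HasPendant : ∀ {n} → VSet n → Set
HasPendant T = ∃[ v ] (v ∈V T × degreeIn T v ≡ 1)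

AdjInAvoiding : ∀ {n} → VSet n → Vertex n → Vertex n → Vertex n → Vertex n → Set
AdjInAvoiding T a b u v = AdjIn T u v × ¬ ((u ≡ a × v ≡ b) ⊎' (u ≡ b × v ≡ a))
  where
  open import Data.Sum using () renaming (_⊎_ to _⊎'_)

-- every walk in Q_n[T] from a to b contains the edge {a, b}, i.e.
-- there is no walk in Q_n[T] from a to b avoiding the edge {a, b}
EveryPathUses : ∀ {n} → VSet n → Vertex n → Vertex n → Set
EveryPathUses T a b = ¬ Star (AdjInAvoiding T a b) a b

Partition : ∀ {n} → VSet n → VSet n → VSet n → Set
Partition T T₁ T₂ = (∀ v → T v ≡ (T₁ v ∨ T₂ v)) × (∀ v → (T₁ v ∧ T₂ v) ≡ false)

-- Everything rests on one counting fact: if Q_n − F has a Hamiltonian cycle and F contains every edge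
-- from an even vertex of a nonempty proper set S to its outside, then |S|₀ < |S|₁, since along the
-- cycle both neighbours of an even vertex of S are odd vertices of S, while some odd vertex of S has a
-- neighbour outside S.  If F is minimal, Q_n − (F ∖ {e}) is Hamiltonian for every fault e; so whenever
-- F cuts S in this way with |S|₀ ≥ |S|₁, every fault is such an "even exit" of S.  Each claim then
-- follows by exhibiting a set that stays cut after one fault is removed: T itself for an internal
-- fault (1); T with one end of an exit edge removed or added (2); a part of T, using that Q_n minus
-- one edge is Hamiltonian for n ≥ 3, for a disconnected or bridged T (3, 5); and for a pendant vertex
-- p with neighbour q, the set {p, q} or T ∖ {p, q} is disconnected halfway (4).

module Submission where

open import Defs
open import Axiom.UniquenessOfIdentityProofs using (module Decidable⇒UIP)
open import Data.Bool using (Bool; true; false; not; _∧_; _∨_; _xor_; if_then_else_)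
open import Data.Bool.Properties using (not-involutive; ∨-comm; ∧-comm; ∨-zeroʳ; ∧-zeroʳ) renaming (_≟_ to _≟B_)
open import Data.Empty using (⊥; ⊥-elim)
open import Data.Fin using (Fin; zero; suc) renaming (_≟_ to _≟F_)
open import Data.List using (List; []; _∷_; _++_; [_]; map; filter; length; allFin)
open import Data.List.Membership.Propositional using (_∈_; _∉_)
open import Data.List.Membership.Propositional.Properties using (∈-allFin; ∈-++⁺ˡ; ∈-++⁺ʳ; ∈-++⁻; ∈-∃++; ∈-map⁺; ∈-map⁻)
open import Data.List.Relation.Unary.All using (All; []; _∷_; lookup)
import Data.List.Relation.Unary.All.Properties as All
open import Data.List.Relation.Unary.Any using (here; there)
open import Data.List.Relation.Unary.Linked using (Linked; []; [-]; _∷_)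
open import Data.List.Relation.Unary.Unique.Propositional using (Unique; []; _∷_)
open import Data.List.Relation.Binary.Permutation.Propositional using (_↭_; ↭-sym; ↭-trans; prep; ↭⇒↭ₛ)
  renaming (refl to ↭-refl)
open import Data.List.Relation.Binary.Permutation.Propositional.Properties
  using (shift; ∷↭∷ʳ; filter-↭; ↭-length; ∈-resp-↭)
open import Data.List.Relation.Binary.Permutation.Setoid.Properties using (Unique-resp-↭)
import Data.List.Relation.Unary.Unique.Propositional.Properties as Unique
open import Data.Nat using (ℕ; zero; suc; _+_; _≤_; _<_; _>_; _≥_; z≤n; s≤s; _≤?_)
open import Data.Nat.Properties using (+-identityʳ; +-comm; suc-injective; ≤-pred; <⇒≤; +-mono-≤-<; ≤-reflexive; +-cancelʳ-≤; <-irrefl; <⇒≱; ≰⇒>; ≤-refl; ≤-trans; +-mono-≤; +-monoʳ-≤; m≤m+n; m≤n+m; module ≤-Reasoning)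
open import Algebra.Properties.CommutativeSemigroup Data.Nat.Properties.+-commutativeSemigroup using (interchange)
open import Data.Product using (Σ-syntax; ∃-syntax; _×_; _,_; proj₁; proj₂)
import Data.Product.Properties as Product
open import Data.Sum using (_⊎_; inj₁; inj₂)
open import Function using (case_of_)
open import Data.Vec using ([]; _∷_; _[_]≔_)
import Data.Vec as Vec
import Data.Vec.Properties as Vec
open import Relation.Binary.Construct.Closure.ReflexiveTransitive using (Star; ε; _◅_; _◅◅_)
  renaming (map to Star-map)
open import Relation.Binary.Definitions using (DecidableEquality)
open import Relation.Binary.PropositionalEquality
  using (_≡_; _≢_; refl; sym; trans; cong; cong₂; subst; subst₂; setoid; module ≡-Reasoning)
open import Relation.Nullary using (¬_; Dec; yes; no; does; contradiction; ¬¬-excluded-middle)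

private
  variable
    n : ℕ
    A B : Set

true≢false : true ≢ false
true≢false ()

∧-true : (a : Bool) {b : Bool} → a ∧ b ≡ true → a ≡ true × b ≡ true
∧-true true {true} _ = refl , refl

half-< : {m k : ℕ} → (m + m) + 1 ≤ k + k → m < k
half-< {m} {k} le = ≰⇒> λ k≤m →
  <-irrefl refl (≤-trans (subst (_≤ k + k) (+-comm (m + m) 1) le) (+-mono-≤ k≤m k≤m))

heavier-part : {a₀ a₁ b₀ b₁ : ℕ} → a₁ + b₁ ≤ a₀ + b₀ → b₀ < b₁ → a₁ < a₀
heavier-part {a₀} {a₁} le b₀<b₁ = ≰⇒> λ a₀≤a₁ → <⇒≱ (+-mono-≤-< a₀≤a₁ b₀<b₁) le

infix 4 _≟V_ _≟E_

_≟V_ : DecidableEquality (Vertex n)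
_≟V_ = Vec.≡-dec _≟B_

flip-involutive : (u : Vertex n) (i : Fin n) → flip (flip u i) i ≡ u
flip-involutive (x ∷ u) zero    = cong (_∷ u) (not-involutive x)
flip-involutive (x ∷ u) (suc i) = cong (x ∷_) (flip-involutive u i)

parity-flip : (u : Vertex n) (i : Fin n) → parity (flip u i) ≡ not (parity u)
parity-flip (false ∷ u) zero    = refl
parity-flip (true ∷ u)  zero    = sym (not-involutive (parity u))
parity-flip (false ∷ u) (suc i) = parity-flip u i
parity-flip (true ∷ u)  (suc i) = cong not (parity-flip u i)

flip-injectiveʳ : (u : Vertex n) {i j : Fin n} → flip u i ≡ flip u j → i ≡ j
flip-injectiveʳ (x ∷ u)     {zero}  {zero}  _ = refl
flip-injectiveʳ (false ∷ u) {zero}  {suc j} ()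
flip-injectiveʳ (true ∷ u)  {zero}  {suc j} ()
flip-injectiveʳ (false ∷ u) {suc i} {zero}  ()
flip-injectiveʳ (true ∷ u)  {suc i} {zero}  ()
flip-injectiveʳ (x ∷ u)     {suc i} {suc j} eq = cong suc (flip-injectiveʳ u (cong Vec.tail eq))

flip-≢ : (u : Vertex n) (i : Fin n) → flip u i ≢ u
flip-≢ (false ∷ u) zero    ()
flip-≢ (true ∷ u)  zero    ()
flip-≢ (x ∷ u)     (suc i) eq = flip-≢ u i (cong Vec.tail eq)

parity-flip-≢ : (u : Vertex n) (i : Fin n) → parity u ≢ parity (flip u i)
parity-flip-≢ u i eq with parity u | parity-flip u i
... | true  | p = contradiction (trans eq p) λ ()
... | false | p = contradiction (trans eq p) λ ()

∷-≢ : {b c : Bool} {x y : Vertex n} → x ≢ y → b ∷ x ≢ c ∷ y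
∷-≢ x≢y eq = x≢y (cong Vec.tail eq)

_≟E_ : DecidableEquality (Edge n)
_≟E_ = Product.≡-dec _≟V_ (Product.≡-dec _≟F_ λ p q → yes (Decidable⇒UIP.≡-irrelevant _≟B_ p q))

private
  ≔-flip : (u : Vertex n) (i : Fin n) (b : Bool) → flip u i [ i ]≔ b ≡ u [ i ]≔ b
  ≔-flip (x ∷ u) zero    b = refl
  ≔-flip (x ∷ u) (suc i) b = cong (x ∷_) (≔-flip u i b)

  ≔-false-injective : (u v : Vertex n) (i : Fin n) → u [ i ]≔ false ≡ v [ i ]≔ false →
                      v ≡ u ⊎ v ≡ flip u i
  ≔-false-injective (false ∷ u) (false ∷ v) zero eq = inj₁ (cong (false ∷_) (sym (cong Vec.tail eq)))
  ≔-false-injective (true ∷ u)  (true ∷ v)  zero eq = inj₁ (cong (true ∷_) (sym (cong Vec.tail eq)))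
  ≔-false-injective (false ∷ u) (true ∷ v)  zero eq = inj₂ (cong (true ∷_) (sym (cong Vec.tail eq)))
  ≔-false-injective (true ∷ u)  (false ∷ v) zero eq = inj₂ (cong (false ∷_) (sym (cong Vec.tail eq)))
  ≔-false-injective (x ∷ u) (y ∷ v) (suc i) eq with cong Vec.head eq
  ... | refl with ≔-false-injective u v i (cong Vec.tail eq)
  ...   | inj₁ v≡u  = inj₁ (cong (x ∷_) v≡u)
  ...   | inj₂ v≡ui = inj₂ (cong (x ∷_) v≡ui)

edgeAt-flip : (u : Vertex n) (i : Fin n) → edgeAt (flip u i) i ≡ edgeAt u i
edgeAt-flip u i with flip u i [ i ]≔ false | ≔-flip u i false | Vec.lookup∘update i (flip u i) false
... | _ | refl | p = cong (λ q → u [ i ]≔ false , i , q) (Decidable⇒UIP.≡-irrelevant _≟B_ p _)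

edgeAt-injective : {n : ℕ} (u v : Vertex n) (i j : Fin n) → edgeAt u i ≡ edgeAt v j →
                   i ≡ j × (v ≡ u ⊎ v ≡ flip u i)
edgeAt-injective {n} u v i j eq with cong (λ (e : Edge n) → proj₁ (proj₂ e)) eq
... | refl = refl , ≔-false-injective u v i (cong proj₁ eq)

edgeAt-suc-injective : (c : Bool) (y : Vertex n) (i : Fin n) (b : Bool) (x : Vertex n) (j : Fin n) →
                       edgeAt (c ∷ y) (suc i) ≡ edgeAt (b ∷ x) (suc j) → edgeAt y i ≡ edgeAt x j
edgeAt-suc-injective c y i b x j eq with edgeAt-injective (c ∷ y) (b ∷ x) (suc i) (suc j) eq
... | refl , inj₁ refl = refl
... | refl , inj₂ refl = sym (edgeAt-flip y i)

∅E : EdgeSet n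
∅E _ = false

｛_｝E : Edge n → EdgeSet n
｛ e ｝E e′ = does (e′ ≟E e)

_-E_ : EdgeSet n → Edge n → EdgeSet n
(F -E e) e′ = F e′ ∧ not (does (e′ ≟E e))

∈-｛｝E : (e : Edge n) → e ∈E ｛ e ｝E
∈-｛｝E e with e ≟E e
... | yes _  = refl
... | no e≢e = contradiction refl e≢e

-E-⊊ : {F : EdgeSet n} {e : Edge n} → e ∈E F → (F -E e) ⊊E F
-E-⊊ {F = F} {e} e∈F = ⊆ , e , e∈F , e∉
  where
  ⊆ : (F -E e) ⊆E F
  ⊆ e′ e′∈ with F e′ | e′∈
  ... | true | _ = refl
  e∉ : e ∉E (F -E e)
  e∉ rewrite e∈F with e ≟E e
  ... | yes _  = refl
  ... | no e≢e = contradiction refl e≢e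

∈-E : {F : EdgeSet n} {e e′ : Edge n} → e′ ∈E F → e′ ≢ e → e′ ∈E (F -E e)
∈-E {e = e} {e′} e′∈F e′≢e rewrite e′∈F with e′ ≟E e
... | yes e′≡e = contradiction e′≡e e′≢e
... | no _     = refl

∉-｛｝E : {e e′ : Edge n} → e′ ≢ e → e′ ∉E ｛ e ｝E
∉-｛｝E {e = e} {e′} e′≢e with e′ ≟E e
... | yes e′≡e = contradiction e′≡e e′≢e
... | no _     = refl

∉-｛｝E⁻ : {e e′ : Edge n} → e′ ∉E ｛ e ｝E → e′ ≢ e
∉-｛｝E⁻ {e = e} e′∉ refl = contradiction (trans (sym (∈-｛｝E e)) e′∉) λ ()

zero-∉-｛zero｝ : (c : Bool) (y : Vertex n) (b : Bool) (x : Vertex n) → y ≢ x →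
                 edgeAt (c ∷ y) zero ∉E ｛ edgeAt (b ∷ x) zero ｝E
zero-∉-｛zero｝ c y b x y≢x = ∉-｛｝E {e = edgeAt (b ∷ x) zero} {edgeAt (c ∷ y) zero} λ eq →
  case edgeAt-injective (c ∷ y) (b ∷ x) zero zero eq of λ
    { (_ , inj₁ refl) → y≢x refl
    ; (_ , inj₂ refl) → y≢x refl }

zero-∉-｛suc｝ : (u v : Vertex (suc n)) (j : Fin n) → edgeAt u zero ∉E ｛ edgeAt v (suc j) ｝E
zero-∉-｛suc｝ u v j = ∉-｛｝E {e = edgeAt v (suc j)} {edgeAt u zero} λ eq →
  case edgeAt-injective u v zero (suc j) eq of λ { (() , _) }

suc-∉-｛zero｝ : (u v : Vertex (suc n)) (i : Fin n) → edgeAt u (suc i) ∉E ｛ edgeAt v zero ｝E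
suc-∉-｛zero｝ u v i = ∉-｛｝E {e = edgeAt v zero} {edgeAt u (suc i)} λ eq →
  case edgeAt-injective u v (suc i) zero eq of λ { (() , _) }

-- Hamiltonian cycles of a hypercube with one faulty edge

final : A → List A → A
final a []       = a
final a (b ∷ bs) = final b bs

final-∷ʳ : (a : A) (bs : List A) (z : A) → final a (bs ++ [ z ]) ≡ z
final-∷ʳ a []       z = refl
final-∷ʳ a (b ∷ bs) z = final-∷ʳ b bs z

Linked-∷ʳ : {R : A → A → Set} {a : A} {bs : List A} {z : A} →
            Linked R (a ∷ bs) → R (final a bs) z → Linked R (a ∷ bs ++ [ z ])
Linked-∷ʳ {bs = []}     [-]        r = r ∷ [-]
Linked-∷ʳ {bs = b ∷ bs} (r′ ∷ rs) r = r′ ∷ Linked-∷ʳ rs r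

Unique-∷ʳ : {xs : List A} {z : A} → Unique xs → z ∉ xs → Unique (xs ++ [ z ])
Unique-∷ʳ u z∉ = Unique.++⁺ u ([] ∷ []) λ { (p , here refl) → z∉ p }

Link-sym : {F : EdgeSet n} {u v : Vertex n} → Link F u v → Link F v u
Link-sym {F = F} {u} (i , refl , ok) =
  i , sym (flip-involutive u i) , subst (λ e → F e ≡ false) (sym (edgeAt-flip u i)) ok

record HamiltonianPath {n} (F : EdgeSet n) (a b : Vertex n) : Set where
  field
    rest     : List (Vertex n)
    unique   : Unique (a ∷ rest)
    complete : ∀ v → v ∈ a ∷ rest
    linked   : Linked (Link F) (a ∷ rest)
    ends     : final a rest ≡ b

close : {F : EdgeSet n} {a b : Vertex n} → HamiltonianPath F a b → Link F b a → Hamiltonian F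
close {F = F} {a = a} P ba =
  a , rest , unique , complete , Linked-∷ʳ linked (subst (λ v → Link F v a) (sym ends) ba)
  where open HamiltonianPath P

-- double [c₁, …, cₖ] = [0c₁, …, 0cₖ, 1cₖ, …, 1c₁]
double : List (Vertex n) → List (Vertex (suc n))
double []       = []
double (c ∷ cs) = (false ∷ c) ∷ double cs ++ [ true ∷ c ]

∈-double : {y : Vertex n} {cs : List (Vertex n)} → y ∈ cs → (b : Bool) → (b ∷ y) ∈ double cs
∈-double {cs = c ∷ cs} (here refl) false = here refl
∈-double {cs = c ∷ cs} (here refl) true  = there (∈-++⁺ʳ (double cs) (here refl))
∈-double {cs = c ∷ cs} (there y∈)  b     = there (∈-++⁺ˡ (∈-double y∈ b))

∈-double⁻ : {b : Bool} {y : Vertex n} (cs : List (Vertex n)) → (b ∷ y) ∈ double cs → y ∈ cs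
∈-double⁻ (c ∷ cs) (here eq) = here (cong Vec.tail eq)
∈-double⁻ (c ∷ cs) (there p) with ∈-++⁻ (double cs) p
... | inj₁ q         = there (∈-double⁻ cs q)
... | inj₂ (here eq) = here (cong Vec.tail eq)

double-unique : {cs : List (Vertex n)} → Unique cs → Unique (double cs)
double-unique {cs = []}     []         = []
double-unique {cs = c ∷ cs} (c∉ ∷ u) =
  All.¬Any⇒All¬ _ false∷c∉ ∷ Unique-∷ʳ (double-unique u) (λ p → c∉cs (∈-double⁻ cs p))
  where
  c∉cs : c ∉ cs
  c∉cs = All.All¬⇒¬Any c∉
  false∷c∉ : (false ∷ c) ∉ double cs ++ [ true ∷ c ]
  false∷c∉ p with ∈-++⁻ (double cs) p
  ... | inj₁ q        = c∉cs (∈-double⁻ cs q)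
  ... | inj₂ (here ())

LiftsTo : EdgeSet n → EdgeSet (suc n) → Set
LiftsTo {n} G F = ∀ (b : Bool) (y : Vertex n) i → edgeAt y i ∉E G → edgeAt (b ∷ y) (suc i) ∉E F

Link-lift : {G : EdgeSet n} {F : EdgeSet (suc n)} → LiftsTo G F →
            (b : Bool) {y z : Vertex n} → Link G y z → Link F (b ∷ y) (b ∷ z)
Link-lift L b {y} (i , refl , ok) = suc i , refl , L b y i ok

double-linked : {G : EdgeSet n} {F : EdgeSet (suc n)} → LiftsTo G F →
                (c : Vertex n) (cs : List (Vertex n)) → Linked (Link G) (c ∷ cs) →
                Link F (false ∷ final c cs) (true ∷ final c cs) → Linked (Link F) (double (c ∷ cs))
double-linked L c []       [-]       turn = turn ∷ [-]
double-linked {G = G} {F} L c (d ∷ ds) (r ∷ rs) turn =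
  Link-lift {G = G} {F} L false r ∷ Linked-∷ʳ (double-linked {G = G} {F} L d ds rs turn)
    (subst (λ v → Link F v (true ∷ c)) (sym (final-∷ʳ (false ∷ d) (double ds) (true ∷ d)))
      (Link-lift {G = G} {F} L true (Link-sym {F = G} r)))

double-path : {G : EdgeSet n} {F : EdgeSet (suc n)} {a l : Vertex n} →
              HamiltonianPath G a l → LiftsTo G F → edgeAt (false ∷ l) zero ∉E F →
              HamiltonianPath F (false ∷ a) (true ∷ a)
double-path {G = G} {F} {a} P L turn = record
  { rest     = double rest ++ [ true ∷ a ]
  ; unique   = double-unique unique
  ; complete = λ { (b ∷ y) → ∈-double (complete y) b }
  ; linked   = double-linked {G = G} {F} L a rest linked
                 (subst (λ v → Link F (false ∷ v) (true ∷ v)) (sym ends) (zero , refl , turn))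
  ; ends     = final-∷ʳ (false ∷ a) (double rest) (true ∷ a)
  }
  where open HamiltonianPath P

lift-∅E : LiftsTo {n} ∅E ∅E
lift-∅E _ _ _ _ = refl

lift-｛zero｝ : (v : Vertex (suc n)) → LiftsTo ∅E ｛ edgeAt v zero ｝E
lift-｛zero｝ v c y i _ = suc-∉-｛zero｝ (c ∷ y) v i

lift-｛｝E : (b : Bool) (x : Vertex n) (j : Fin n) → LiftsTo ｛ edgeAt x j ｝E ｛ edgeAt (b ∷ x) (suc j) ｝E
lift-｛｝E b x j c y i ok = ∉-｛｝E {e = edgeAt (b ∷ x) (suc j)} {edgeAt (c ∷ y) (suc i)} λ eq →
  ∉-｛｝E⁻ {e = edgeAt x j} ok (edgeAt-suc-injective c y i b x j eq)

double-∅E : {a l : Vertex n} → HamiltonianPath ∅E a l → HamiltonianPath ∅E (false ∷ a) (true ∷ a)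
double-∅E P = double-path {G = ∅E} {∅E} P lift-∅E refl

edge-path : (p : Bool) → HamiltonianPath ∅E (p ∷ []) (not p ∷ [])
edge-path false = record
  { rest = (true ∷ []) ∷ [] ; unique = ((λ ()) ∷ []) ∷ [] ∷ []
  ; complete = λ { (false ∷ []) → here refl ; (true ∷ []) → there (here refl) }
  ; linked = (zero , refl , refl) ∷ [-] ; ends = refl }
edge-path true = record
  { rest = (false ∷ []) ∷ [] ; unique = ((λ ()) ∷ []) ∷ [] ∷ []
  ; complete = λ { (true ∷ []) → here refl ; (false ∷ []) → there (here refl) }
  ; linked = (zero , refl , refl) ∷ [-] ; ends = refl }

not-∷[]-≢ : (p : Bool) → _≢_ {A = Vertex 1} (not p ∷ []) (p ∷ [])
not-∷[]-≢ false ()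
not-∷[]-≢ true  ()

path-avoiding-ends : (y : Vertex (suc (suc n))) →
                     Σ[ a ∈ Vertex (suc (suc n)) ] Σ[ l ∈ Vertex (suc (suc n)) ] (HamiltonianPath ∅E a l × a ≢ y × l ≢ y)
path-avoiding-ends {zero} (b ∷ c ∷ []) = _ , _ , double-∅E (edge-path (not c)) , ∷-≢ (not-∷[]-≢ c) , ∷-≢ (not-∷[]-≢ c)
path-avoiding-ends {suc n} (b ∷ y) with path-avoiding-ends y
... | _ , _ , P , a≢y , _ = _ , _ , double-∅E P , ∷-≢ a≢y , ∷-≢ a≢y

path-avoiding-end : (y : Vertex (suc n)) →
                    Σ[ a ∈ Vertex (suc n) ] Σ[ l ∈ Vertex (suc n) ] (HamiltonianPath ∅E a l × l ≢ y)
path-avoiding-end {zero}  (p ∷ []) = _ , _ , edge-path p , not-∷[]-≢ p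
path-avoiding-end {suc n} y with path-avoiding-ends y
... | _ , _ , P , _ , l≢y = _ , _ , P , l≢y

square-path : (b c : Bool) →
              HamiltonianPath ｛ edgeAt (b ∷ c ∷ []) (suc zero) ｝E (b ∷ c ∷ []) (b ∷ not c ∷ [])
square-path false false = record
  { rest = (true ∷ false ∷ []) ∷ (true ∷ true ∷ []) ∷ (false ∷ true ∷ []) ∷ []
  ; unique = ((λ ()) ∷ (λ ()) ∷ (λ ()) ∷ []) ∷ ((λ ()) ∷ (λ ()) ∷ []) ∷ ((λ ()) ∷ []) ∷ [] ∷ []
  ; complete = λ { (false ∷ false ∷ []) → here refl ; (true ∷ false ∷ []) → there (here refl)
                 ; (true ∷ true ∷ []) → there (there (here refl)) ; (false ∷ true ∷ []) → there (there (there (here refl))) }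
  ; linked = (zero , refl , refl) ∷ (suc zero , refl , refl) ∷ (zero , refl , refl) ∷ [-] ; ends = refl }
square-path false true = record
  { rest = (true ∷ true ∷ []) ∷ (true ∷ false ∷ []) ∷ (false ∷ false ∷ []) ∷ []
  ; unique = ((λ ()) ∷ (λ ()) ∷ (λ ()) ∷ []) ∷ ((λ ()) ∷ (λ ()) ∷ []) ∷ ((λ ()) ∷ []) ∷ [] ∷ []
  ; complete = λ { (false ∷ true ∷ []) → here refl ; (true ∷ true ∷ []) → there (here refl)
                 ; (true ∷ false ∷ []) → there (there (here refl)) ; (false ∷ false ∷ []) → there (there (there (here refl))) }
  ; linked = (zero , refl , refl) ∷ (suc zero , refl , refl) ∷ (zero , refl , refl) ∷ [-] ; ends = refl }
square-path true false = record
  { rest = (false ∷ false ∷ []) ∷ (false ∷ true ∷ []) ∷ (true ∷ true ∷ []) ∷ []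
  ; unique = ((λ ()) ∷ (λ ()) ∷ (λ ()) ∷ []) ∷ ((λ ()) ∷ (λ ()) ∷ []) ∷ ((λ ()) ∷ []) ∷ [] ∷ []
  ; complete = λ { (true ∷ false ∷ []) → here refl ; (false ∷ false ∷ []) → there (here refl)
                 ; (false ∷ true ∷ []) → there (there (here refl)) ; (true ∷ true ∷ []) → there (there (there (here refl))) }
  ; linked = (zero , refl , refl) ∷ (suc zero , refl , refl) ∷ (zero , refl , refl) ∷ [-] ; ends = refl }
square-path true true = record
  { rest = (false ∷ true ∷ []) ∷ (false ∷ false ∷ []) ∷ (true ∷ false ∷ []) ∷ []
  ; unique = ((λ ()) ∷ (λ ()) ∷ (λ ()) ∷ []) ∷ ((λ ()) ∷ (λ ()) ∷ []) ∷ ((λ ()) ∷ []) ∷ [] ∷ []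
  ; complete = λ { (true ∷ true ∷ []) → here refl ; (false ∷ true ∷ []) → there (here refl)
                 ; (false ∷ false ∷ []) → there (there (here refl)) ; (true ∷ false ∷ []) → there (there (there (here refl))) }
  ; linked = (zero , refl , refl) ∷ (suc zero , refl , refl) ∷ (zero , refl , refl) ∷ [-] ; ends = refl }

path-avoiding-edge : (x : Vertex (suc (suc n))) (j : Fin (suc (suc n))) →
                     Σ[ a ∈ Vertex (suc (suc n)) ] Σ[ l ∈ Vertex (suc (suc n)) ] HamiltonianPath ｛ edgeAt x j ｝E a l
path-avoiding-edge (b ∷ x) zero with path-avoiding-end x
... | _ , l , P , l≢x =
  _ , _ , double-path {G = ∅E} {｛ edgeAt (b ∷ x) zero ｝E} P (lift-｛zero｝ (b ∷ x)) (zero-∉-｛zero｝ false l b x l≢x)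
path-avoiding-edge {zero}  (b ∷ c ∷ []) (suc zero) = _ , _ , square-path b c
path-avoiding-edge {suc n} (b ∷ x) (suc j) with path-avoiding-edge x j
... | _ , l , P =
  _ , _ , double-path {G = ｛ edgeAt x j ｝E} {｛ edgeAt (b ∷ x) (suc j) ｝E} P (lift-｛｝E b x j)
            (zero-∉-｛suc｝ (false ∷ l) (b ∷ x) j)

-- The cycle doubles a path P of the lower half and uses only two edges along the first coordinate, at
-- the end points of P; P is chosen so that neither of them is the faulty edge.
Hamiltonian-｛｝E : 3 ≤ n → (u : Vertex n) (i : Fin n) → Hamiltonian ｛ edgeAt u i ｝E
Hamiltonian-｛｝E (s≤s (s≤s (s≤s _))) (b ∷ x) zero with path-avoiding-ends x
... | a , l , P , a≢x , l≢x =
  close {F = ｛ edgeAt (b ∷ x) zero ｝E}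
    (double-path {G = ∅E} P (lift-｛zero｝ (b ∷ x)) (zero-∉-｛zero｝ false l b x l≢x))
    (zero , refl , zero-∉-｛zero｝ true a b x a≢x)
Hamiltonian-｛｝E (s≤s (s≤s (s≤s _))) (b ∷ x) (suc j) with path-avoiding-edge x j
... | a , l , P =
  close {F = ｛ edgeAt (b ∷ x) (suc j) ｝E}
    (double-path {G = ｛ edgeAt x j ｝E} P (lift-｛｝E b x j) (zero-∉-｛suc｝ (false ∷ l) (b ∷ x) j))
    (zero , refl , zero-∉-｛suc｝ (true ∷ a) (b ∷ x) j)

𝟙 : Bool → ℕ
𝟙 true  = 1
𝟙 false = 0

countIn : (A → Bool) → List A → ℕ
countIn P xs = length (filter (λ x → P x ≟B true) xs)

countIn-∷ : (P : A → Bool) (x : A) (xs : List A) → countIn P (x ∷ xs) ≡ 𝟙 (P x) + countIn P xs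
countIn-∷ P x xs with P x
... | true  = refl
... | false = refl

countIn-↭ : (P : A → Bool) {xs ys : List A} → xs ↭ ys → countIn P xs ≡ countIn P ys
countIn-↭ P xs↭ys = ↭-length (filter-↭ (λ x → P x ≟B true) xs↭ys)

countIn-cong : {P Q : A → Bool} → (∀ x → P x ≡ Q x) → (xs : List A) → countIn P xs ≡ countIn Q xs
countIn-cong         P≗Q []       = refl
countIn-cong {P = P} {Q} P≗Q (x ∷ xs) = begin
  countIn P (x ∷ xs)      ≡⟨ countIn-∷ P x xs ⟩
  𝟙 (P x) + countIn P xs  ≡⟨ cong₂ _+_ (cong 𝟙 (P≗Q x)) (countIn-cong P≗Q xs) ⟩
  𝟙 (Q x) + countIn Q xs  ≡⟨ sym (countIn-∷ Q x xs) ⟩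
  countIn Q (x ∷ xs)      ∎
  where open ≡-Reasoning

countIn-partition : {P Q R : A → Bool} → (∀ x → P x ≡ Q x ∨ R x) → (∀ x → Q x ∧ R x ≡ false) →
                    (xs : List A) → countIn P xs ≡ countIn Q xs + countIn R xs
countIn-partition P≡ QR≡ [] = refl
countIn-partition {P = P} {Q} {R} P≡ QR≡ (x ∷ xs) = begin
  countIn P (x ∷ xs)                          ≡⟨ countIn-∷ P x xs ⟩
  𝟙 (P x) + countIn P xs                      ≡⟨ cong₂ _+_ (𝟙-∨ {q = Q x} {R x} (P≡ x) (QR≡ x)) (countIn-partition {Q = Q} {R} P≡ QR≡ xs) ⟩
  (𝟙 (Q x) + 𝟙 (R x)) + (countIn Q xs + countIn R xs) ≡⟨ interchange (𝟙 (Q x)) (𝟙 (R x)) _ _ ⟩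
  (𝟙 (Q x) + countIn Q xs) + (𝟙 (R x) + countIn R xs) ≡⟨ sym (cong₂ _+_ (countIn-∷ Q x xs) (countIn-∷ R x xs)) ⟩
  countIn Q (x ∷ xs) + countIn R (x ∷ xs)     ∎
  where
  open ≡-Reasoning
  𝟙-∨ : {p q r : Bool} → p ≡ q ∨ r → q ∧ r ≡ false → 𝟙 p ≡ 𝟙 q + 𝟙 r
  𝟙-∨ {q = true}  {false} refl _ = refl
  𝟙-∨ {q = false} {true}  refl _ = refl
  𝟙-∨ {q = false} {false} refl _ = refl

countIn-map : (P : B → Bool) (f : A → B) (xs : List A) → countIn P (map f xs) ≡ countIn (λ x → P (f x)) xs
countIn-map P f []       = refl
countIn-map P f (x ∷ xs) = begin
  countIn P (map f (x ∷ xs))             ≡⟨ countIn-∷ P (f x) (map f xs) ⟩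
  𝟙 (P (f x)) + countIn P (map f xs)     ≡⟨ cong (𝟙 (P (f x)) +_) (countIn-map P f xs) ⟩
  𝟙 (P (f x)) + countIn (λ x → P (f x)) xs ≡⟨ sym (countIn-∷ (λ x → P (f x)) x xs) ⟩
  countIn (λ x → P (f x)) (x ∷ xs)       ∎
  where open ≡-Reasoning

countIn-zero : (P : A → Bool) (xs : List A) → (∀ x → x ∈ xs → P x ≡ false) → countIn P xs ≡ 0
countIn-zero P []       _    = refl
countIn-zero P (x ∷ xs) none rewrite countIn-∷ P x xs | none x (here refl) =
  countIn-zero P xs (λ y y∈ → none y (there y∈))

countIn-zero⁻ : (P : A → Bool) (xs : List A) → countIn P xs ≡ 0 → ∀ x → x ∈ xs → P x ≡ false
countIn-zero⁻ P (x ∷ xs) none y y∈ with P x in Px | y∈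
... | false | here refl = Px
... | false | there y∈′ = countIn-zero⁻ P xs none y y∈′

countIn-single : (P : A → Bool) {w : A} {xs : List A} → Unique xs → w ∈ xs → (∀ x → P x ≡ true → x ≡ w) →
                 countIn P xs ≡ 𝟙 (P w)
countIn-single P {xs = x ∷ xs} (x∉ ∷ u) (here refl) only rewrite countIn-∷ P x xs =
  trans (cong (𝟙 (P x) +_) (countIn-zero P xs λ y y∈ → P-false y y∈)) (+-identityʳ _)
  where
  P-false : ∀ y → y ∈ xs → P y ≡ false
  P-false y y∈ with P y in Py
  ... | true  = contradiction (subst (_∈ xs) (only y Py) y∈) (All.All¬⇒¬Any x∉)
  ... | false = refl
countIn-single P {xs = x ∷ xs} (x∉ ∷ u) (there w∈) only rewrite countIn-∷ P x xs with P x in Px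
... | true  = contradiction (subst (_∈ xs) (sym (only x Px)) w∈) (All.All¬⇒¬Any x∉)
... | false = countIn-single P u w∈ only

countIn-pos : (P : A → Bool) (xs : List A) → 1 ≤ countIn P xs → ∃[ x ] P x ≡ true
countIn-pos P (x ∷ xs) pos with P x in Px
... | true  = x , Px
... | false = countIn-pos P xs pos

countIn-one : (P : A → Bool) (xs : List A) → countIn P xs ≡ 1 →
              Σ[ x ∈ A ] (P x ≡ true × (∀ y → y ∈ xs → P y ≡ true → y ≡ x))
countIn-one P (x ∷ xs) one with P x in Px
... | true  = x , Px , λ
  { y (here refl) _  → refl
  ; y (there y∈)  Py → contradiction (trans (sym Py) (countIn-zero⁻ P xs (suc-injective one) y y∈)) λ () }
... | false with countIn-one P xs one
...   | x′ , Px′ , only = x′ , Px′ , λ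
  { y (here refl) Py → contradiction (trans (sym Py) Px) λ ()
  ; y (there y∈)  Py → only y y∈ Py }

same-elements⇒↭ : {xs ys : List A} → Unique xs → Unique ys →
           (∀ {v} → v ∈ xs → v ∈ ys) → (∀ {v} → v ∈ ys → v ∈ xs) → xs ↭ ys
same-elements⇒↭ {xs = []}     {[]}     _ _ _ _    = ↭-refl
same-elements⇒↭ {xs = []}     {y ∷ ys} _ _ _ back = contradiction (back (here refl)) λ ()
same-elements⇒↭ {A = A} {xs = x ∷ xs} (x∉xs ∷ uxs) uys to back with ∈-∃++ (to (here refl))
... | as , bs , refl = ↭-trans (prep x (same-elements⇒↭ uxs uas++bs to′ back′)) (↭-sym (shift x as bs))
  where
  x∷as++bs-unique : Unique (x ∷ as ++ bs)
  x∷as++bs-unique = Unique-resp-↭ (setoid A) (↭⇒↭ₛ (shift x as bs)) uys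
  uas++bs : Unique (as ++ bs)
  uas++bs with x∷as++bs-unique
  ... | _ ∷ u = u
  to′ : ∀ {v} → v ∈ xs → v ∈ as ++ bs
  to′ {v} v∈ with ∈-resp-↭ (shift x as bs) (to (there v∈))
  ... | here refl = contradiction v∈ (All.All¬⇒¬Any x∉xs)
  ... | there v∈′ = v∈′
  back′ : ∀ {v} → v ∈ as ++ bs → v ∈ xs
  back′ {v} v∈ with back (∈-resp-↭ (↭-sym (shift x as bs)) (there v∈)) | x∷as++bs-unique
  ... | here refl | x∉ ∷ _ = contradiction v∈ (All.All¬⇒¬Any x∉)
  ... | there v∈′ | _      = v∈′

∈-allVertices : (v : Vertex n) → v ∈ allVertices n
∈-allVertices []          = here refl
∈-allVertices (false ∷ v) = ∈-++⁺ˡ (∈-map⁺ (false ∷_) (∈-allVertices v))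
∈-allVertices (true ∷ v)  = ∈-++⁺ʳ (map (false ∷_) (allVertices _)) (∈-map⁺ (true ∷_) (∈-allVertices v))

allVertices-unique : (n : ℕ) → Unique (allVertices n)
allVertices-unique zero    = [] ∷ []
allVertices-unique (suc n) =
  Unique.++⁺ (Unique.map⁺ (cong Vec.tail) (allVertices-unique n)) (Unique.map⁺ (cong Vec.tail) (allVertices-unique n))
    λ (p , q) → halves-disjoint (∈-map⁻ (false ∷_) p) (∈-map⁻ (true ∷_) q)
  where
  halves-disjoint : ∀ {v} → Σ[ x ∈ Vertex n ] (x ∈ allVertices n × v ≡ false ∷ x) →
          Σ[ x ∈ Vertex n ] (x ∈ allVertices n × v ≡ true ∷ x) → ⊥
  halves-disjoint (_ , _ , refl) (_ , _ , ())

↭-allVertices : {xs : List (Vertex n)} → Unique xs → (∀ v → v ∈ xs) → xs ↭ allVertices n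
↭-allVertices uxs complete = same-elements⇒↭ uxs (allVertices-unique _) (λ {v} _ → ∈-allVertices v) (λ {v} _ → complete v)

-- sizeP b S unfolds to countIn (λ v → S v ∧ hasParity b v) (allVertices n).
hasParity : Bool → Vertex n → Bool
hasParity b v = if parity v then b else not b

full : VSet n
full _ = true

｛_｝ : Vertex n → VSet n
｛ w ｝ v = does (v ≟V w)

infixl 6 _∪_ _∖_

_∪_ _∖_ : VSet n → VSet n → VSet n
(S ∪ R) v = S v ∨ R v
(S ∖ R) v = S v ∧ not (R v)

∈-｛｝ : (w : Vertex n) → w ∈V ｛ w ｝
∈-｛｝ w with w ≟V w
... | yes _  = refl
... | no w≢w = contradiction refl w≢w

∈-｛｝⁻ : {v w : Vertex n} → v ∈V ｛ w ｝ → v ≡ w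
∈-｛｝⁻ {v = v} {w} v∈ with v ≟V w
... | yes v≡w = v≡w

∉-｛｝ : {v w : Vertex n} → v ≢ w → v ∉V ｛ w ｝
∉-｛｝ {v = v} {w} v≢w with v ≟V w
... | yes v≡w = contradiction v≡w v≢w
... | no _    = refl

∈-∪⁻ : (S R : VSet n) {v : Vertex n} → v ∈V (S ∪ R) → v ∈V S ⊎ v ∈V R
∈-∪⁻ S R {v} v∈ with S v
... | true  = inj₁ refl
... | false = inj₂ v∈

∉-∪⁻ : (S R : VSet n) {v : Vertex n} → v ∉V (S ∪ R) → v ∉V S × v ∉V R
∉-∪⁻ S R {v} v∉ with S v | R v
... | false | false = refl , refl

∈-∖⁻ : (S R : VSet n) {v : Vertex n} → v ∈V (S ∖ R) → v ∈V S × v ∉V R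
∈-∖⁻ S R {v} v∈ with S v | R v
... | true | false = refl , refl

∉-∖⁻ : (S R : VSet n) {v : Vertex n} → v ∉V (S ∖ R) → v ∉V S ⊎ v ∈V R
∉-∖⁻ S R {v} v∉ with S v | R v
... | false | _    = inj₁ refl
... | true  | true = inj₂ refl

∈-∪⁺ˡ : (S R : VSet n) {v : Vertex n} → v ∈V S → v ∈V (S ∪ R)
∈-∪⁺ˡ S R v∈S rewrite v∈S = refl

∉-∪⁺ : (S R : VSet n) {v : Vertex n} → v ∉V S → v ∉V R → v ∉V (S ∪ R)
∉-∪⁺ S R v∉S v∉R rewrite v∉S = v∉R

∉-∖⁺ˡ : (S R : VSet n) {v : Vertex n} → v ∉V S → v ∉V (S ∖ R)
∉-∖⁺ˡ S R v∉S rewrite v∉S = refl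

∈-∖⁺ : (S R : VSet n) {v : Vertex n} → v ∈V S → v ∉V R → v ∈V (S ∖ R)
∈-∖⁺ S R v∈S v∉R rewrite v∈S | v∉R = refl

⊆⇒∉ : {S T : VSet n} → S ⊆V T → {v : Vertex n} → v ∉V T → v ∉V S
⊆⇒∉ {S = S} S⊆T {v} v∉T with S v in v∈S
... | true  = ⊥-elim (true≢false (trans (sym (S⊆T v v∈S)) v∉T))
... | false = refl

Partition-∪ : {A B : VSet n} → (∀ v → A v ∧ B v ≡ false) → Partition (A ∪ B) A B
Partition-∪ disjoint = (λ _ → refl) , disjoint

Partition-∖ : {S R : VSet n} → R ⊆V S → Partition S (S ∖ R) R
Partition-∖ {S = S} {R} R⊆S = cover , disjoint
  where
  cover : ∀ v → S v ≡ (S v ∧ not (R v)) ∨ R v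
  cover v with R v in Rv | S v in Sv
  ... | false | true  = refl
  ... | false | false = refl
  ... | true  | true  = refl
  ... | true  | false = trans (sym Sv) (R⊆S v Rv)
  disjoint : ∀ v → (S v ∧ not (R v)) ∧ R v ≡ false
  disjoint v with S v | R v
  ... | true  | true  = refl
  ... | true  | false = refl
  ... | false | _     = refl

Partition-∖｛｝ : (S : VSet n) {w : Vertex n} → w ∈V S → Partition S (S ∖ ｛ w ｝) ｛ w ｝
Partition-∖｛｝ S {w} w∈S = Partition-∖ {S = S} {｛ w ｝} λ v v∈ → subst (_∈V S) (sym (∈-｛｝⁻ v∈)) w∈S

Partition-comm : {T A B : VSet n} → Partition T A B → Partition T B A
Partition-comm {A = A} {B} (cover , disjoint) =
  (λ v → trans (cover v) (∨-comm (A v) (B v))) , (λ v → trans (∧-comm (B v) (A v)) (disjoint v))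

⊆-Partition : {T A B : VSet n} → Partition T A B → A ⊆V T × B ⊆V T
⊆-Partition {A = A} {B} (cover , _) = (λ v v∈A → trans (cover v) (cong (_∨ B v) v∈A)) ,
                                       (λ v v∈B → trans (cover v) (trans (cong (A v ∨_) v∈B) (∨-zeroʳ (A v))))

Partition-∉ : {T A B : VSet n} → Partition T A B → {v : Vertex n} → v ∈V A → v ∉V B
Partition-∉ {B = B} (_ , disjoint) {v} v∈A = trans (cong (_∧ B v) (sym v∈A)) (disjoint v)

Partition-∈ : {T A B : VSet n} → Partition T A B → {v : Vertex n} → v ∈V T → v ∉V A → v ∈V B
Partition-∈ {B = B} (cover , _) {v} v∈T v∉A = trans (sym (cong (_∨ B v) v∉A)) (trans (sym (cover v)) v∈T)

size-partition : {T A B : VSet n} → Partition T A B → size T ≡ size A + size B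
size-partition (cover , disjoint) = countIn-partition cover disjoint (allVertices _)

sizeP-partition : {T A B : VSet n} → Partition T A B → (b : Bool) → sizeP b T ≡ sizeP b A + sizeP b B
sizeP-partition {T = T} {A} {B} (cover , disjoint) b = countIn-partition cover′ disjoint′ (allVertices _)
  where
  cover′ : ∀ v → T v ∧ hasParity b v ≡ (A v ∧ hasParity b v) ∨ (B v ∧ hasParity b v)
  cover′ v rewrite cover v with A v | B v | hasParity b v
  ... | true  | _     | true  = refl
  ... | false | true  | true  = refl
  ... | false | false | true  = refl
  ... | true  | true  | false = refl
  ... | true  | false | false = refl
  ... | false | _     | false = refl
  disjoint′ : ∀ v → (A v ∧ hasParity b v) ∧ (B v ∧ hasParity b v) ≡ false
  disjoint′ v with A v | B v | hasParity b v | disjoint v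
  ... | true  | true  | _     | ()
  ... | true  | false | true  | _ = refl
  ... | true  | false | false | _ = refl
  ... | false | _     | _     | _ = refl

size-｛｝ : (w : Vertex n) → size ｛ w ｝ ≡ 1
size-｛｝ w = trans (countIn-single ｛ w ｝ (allVertices-unique _) (∈-allVertices w) (λ _ → ∈-｛｝⁻))
                   (cong 𝟙 (∈-｛｝ w))

sizeP-｛｝ : (b : Bool) (w : Vertex n) → parity w ≡ b → sizeP b ｛ w ｝ ≡ 1 × sizeP (not b) ｛ w ｝ ≡ 0
sizeP-｛｝ b w pw = trans (count b) (cong 𝟙 (same b pw)) , trans (count (not b)) (cong 𝟙 (other b pw))
  where
  count : ∀ b′ → sizeP b′ ｛ w ｝ ≡ 𝟙 (｛ w ｝ w ∧ hasParity b′ w)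
  count b′ = countIn-single _ (allVertices-unique _) (∈-allVertices w)
               (λ v v∈ → ∈-｛｝⁻ (proj₁ (∧-true (｛ w ｝ v) v∈)))
  same : ∀ b → parity w ≡ b → ｛ w ｝ w ∧ hasParity b w ≡ true
  same false pw rewrite ∈-｛｝ w | pw = refl
  same true  pw rewrite ∈-｛｝ w | pw = refl
  other : ∀ b → parity w ≡ b → ｛ w ｝ w ∧ hasParity (not b) w ≡ false
  other false pw rewrite ∈-｛｝ w | pw = refl
  other true  pw rewrite ∈-｛｝ w | pw = refl

size-pos : (S : VSet n) → 1 ≤ size S → ∃[ v ] v ∈V S
size-pos S = countIn-pos S (allVertices _)

sizeP-pos : (b : Bool) (S : VSet n) → 1 ≤ sizeP b S → ∃[ v ] v ∈V S
sizeP-pos b S pos with countIn-pos (λ v → S v ∧ hasParity b v) (allVertices _) pos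
... | v , v∈ = v , proj₁ (∧-true (S v) v∈)

sizeP-∪｛｝ : (S : VSet n) {w : Vertex n} {b : Bool} → w ∉V S → parity w ≡ b →
              sizeP b (S ∪ ｛ w ｝) ≡ sizeP b S + 1 × sizeP (not b) (S ∪ ｛ w ｝) ≡ sizeP (not b) S
sizeP-∪｛｝ S {w} {b} w∉S pw =
  trans (sizeP-partition split b) (cong (sizeP b S +_) one) ,
  trans (sizeP-partition split (not b)) (trans (cong (sizeP (not b) S +_) zero′) (+-identityʳ _))
  where
  split : Partition (S ∪ ｛ w ｝) S ｛ w ｝
  split = Partition-∪ {A = S} {｛ w ｝} disjoint
    where
    disjoint : ∀ v → S v ∧ ｛ w ｝ v ≡ false
    disjoint v with S v in Sv | v ≟V w
    ... | true  | yes refl = contradiction (trans (sym Sv) w∉S) λ ()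
    ... | true  | no _     = refl
    ... | false | _        = refl
  one   = proj₁ (sizeP-｛｝ b w pw)
  zero′ = proj₂ (sizeP-｛｝ b w pw)

sizeP-∖｛｝ : (S : VSet n) {w : Vertex n} {b : Bool} → w ∈V S → parity w ≡ b →
              sizeP b S ≡ sizeP b (S ∖ ｛ w ｝) + 1 × sizeP (not b) S ≡ sizeP (not b) (S ∖ ｛ w ｝)
sizeP-∖｛｝ S {w} {b} w∈S pw =
  trans (sizeP-partition split b) (cong (sizeP b (S ∖ ｛ w ｝) +_) (proj₁ (sizeP-｛｝ b w pw))) ,
  trans (sizeP-partition split (not b)) (trans (cong (sizeP (not b) (S ∖ ｛ w ｝) +_) (proj₂ (sizeP-｛｝ b w pw))) (+-identityʳ _))
  where
  split = Partition-∖｛｝ S w∈S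

size-∖｛｝ : (S : VSet n) {w : Vertex n} → w ∈V S → size S ≡ size (S ∖ ｛ w ｝) + 1
size-∖｛｝ S {w} w∈S =
  trans (size-partition (Partition-∖｛｝ S w∈S)) (cong (size (S ∖ ｛ w ｝) +_) (size-｛｝ w))

size₀-full≡size₁-full : Fin n → size₀ (full {n}) ≡ size₁ (full {n})
size₀-full≡size₁-full {n} i = begin
  countIn even (allVertices n)                  ≡⟨ countIn-↭ even (↭-sym flipped↭) ⟩
  countIn even (map flipᵢ (allVertices n))      ≡⟨ countIn-map even flipᵢ (allVertices n) ⟩
  countIn (λ v → even (flipᵢ v)) (allVertices n) ≡⟨ countIn-cong even∘flipᵢ (allVertices n) ⟩
  countIn odd (allVertices n)                   ∎
  where
  open ≡-Reasoning
  even odd : Vertex n → Bool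
  even v = true ∧ hasParity false v
  odd  v = true ∧ hasParity true v
  flipᵢ : Vertex n → Vertex n
  flipᵢ v = flip v i
  flipped↭ : map flipᵢ (allVertices n) ↭ allVertices n
  flipped↭ = ↭-allVertices
    (Unique.map⁺ (λ {u} {v} eq → trans (sym (flip-involutive u i)) (trans (cong flipᵢ eq) (flip-involutive v i)))
                 (allVertices-unique n))
    (λ v → subst (_∈ map flipᵢ (allVertices n)) (flip-involutive v i) (∈-map⁺ flipᵢ (∈-allVertices (flipᵢ v))))
  even∘flipᵢ : ∀ v → even (flipᵢ v) ≡ odd v
  even∘flipᵢ v rewrite parity-flip v i with parity v
  ... | true  = refl
  ... | false = refl

sizeP-full : (b : Bool) {S : VSet n} → (∀ v → v ∈V S) → sizeP b S ≡ sizeP b (full {n})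
sizeP-full {n} b {S} all∈S = countIn-cong (λ v → cong (_∧ hasParity b v) (all∈S v)) (allVertices n)

-- Hamiltonian cycles and half-cut sets

Σ-steps : (A → A → ℕ) → List A → ℕ
Σ-steps f []           = 0
Σ-steps f (a ∷ [])     = 0
Σ-steps f (a ∷ b ∷ cs) = f a b + Σ-steps f (b ∷ cs)

Σ-steps-mono : {R : A → A → Set} {f g : A → A → ℕ} {xs : List A} → Linked R xs →
               (∀ {a b} → R a b → f a b ≤ g a b) → Σ-steps f xs ≤ Σ-steps g xs
Σ-steps-mono []        f≤g = z≤n
Σ-steps-mono [-]       f≤g = z≤n
Σ-steps-mono (r ∷ rs) f≤g = +-mono-≤ (f≤g r) (Σ-steps-mono rs f≤g)

Σ-steps-+ : (f g : A → A → ℕ) (xs : List A) → Σ-steps (λ a b → f a b + g a b) xs ≡ Σ-steps f xs + Σ-steps g xs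
Σ-steps-+ f g []           = refl
Σ-steps-+ f g (a ∷ [])     = refl
Σ-steps-+ f g (a ∷ b ∷ cs) = trans (cong (f a b + g a b +_) (Σ-steps-+ f g (b ∷ cs))) (interchange (f a b) (g a b) _ _)

Σ-steps-source : (P : A → Bool) (x : A) (xs : List A) (z : A) →
                 Σ-steps (λ a _ → 𝟙 (P a)) (x ∷ xs ++ [ z ]) ≡ countIn P (x ∷ xs)
Σ-steps-source P x []       z = trans (+-identityʳ (𝟙 (P x))) (sym (trans (countIn-∷ P x []) (+-identityʳ _)))
Σ-steps-source P x (y ∷ ys) z = trans (cong (𝟙 (P x) +_) (Σ-steps-source P y ys z)) (sym (countIn-∷ P x (y ∷ ys)))

Σ-steps-target : (P : A → Bool) (x : A) (xs : List A) → Σ-steps (λ _ b → 𝟙 (P b)) (x ∷ xs) ≡ countIn P xs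
Σ-steps-target P x []       = refl
Σ-steps-target P x (y ∷ ys) = trans (cong (𝟙 (P y) +_) (Σ-steps-target P y ys)) (sym (countIn-∷ P y ys))

Σ-steps-closed : (P : A → Bool) (x : A) (xs : List A) →
                 Σ-steps (λ a b → 𝟙 (P a) + 𝟙 (P b)) (x ∷ xs ++ [ x ]) ≡ countIn P (x ∷ xs) + countIn P (x ∷ xs)
Σ-steps-closed P x xs = begin
  Σ-steps (λ a b → 𝟙 (P a) + 𝟙 (P b)) (x ∷ xs ++ [ x ])
    ≡⟨ Σ-steps-+ (λ a _ → 𝟙 (P a)) (λ _ b → 𝟙 (P b)) (x ∷ xs ++ [ x ]) ⟩
  Σ-steps (λ a _ → 𝟙 (P a)) (x ∷ xs ++ [ x ]) + Σ-steps (λ _ b → 𝟙 (P b)) (x ∷ xs ++ [ x ])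
    ≡⟨ cong₂ _+_ (Σ-steps-source P x xs x) (Σ-steps-target P x (xs ++ [ x ])) ⟩
  countIn P (x ∷ xs) + countIn P (xs ++ [ x ])
    ≡⟨ cong (countIn P (x ∷ xs) +_) (countIn-↭ P (↭-sym (∷↭∷ʳ x xs))) ⟩
  countIn P (x ∷ xs) + countIn P (x ∷ xs) ∎
  where open ≡-Reasoning

Σ-steps-xor-pos : (P : A → Bool) (x : A) (xs : List A) {y : A} → y ∈ x ∷ xs → P x ≢ P y →
                  1 ≤ Σ-steps (λ a b → 𝟙 (P a xor P b)) (x ∷ xs)
Σ-steps-xor-pos P x xs       (here refl) Px≢Py = contradiction refl Px≢Py
Σ-steps-xor-pos P x (c ∷ cs) (there y∈) Px≢Py with P x ≟B P c
... | no Px≢Pc = ≤-trans (xor-pos Px≢Pc) (m≤m+n _ _)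
  where
  xor-pos : ∀ {p q} → p ≢ q → 1 ≤ 𝟙 (p xor q)
  xor-pos {false} {false} p≢q = contradiction refl p≢q
  xor-pos {false} {true}  _   = s≤s z≤n
  xor-pos {true}  {false} _   = s≤s z≤n
  xor-pos {true}  {true}  p≢q = contradiction refl p≢q
... | yes Px≡Pc = ≤-trans (Σ-steps-xor-pos P c cs y∈ (λ Pc≡Py → Px≢Py (trans Px≡Pc Pc≡Py))) (m≤n+m _ _)

module _ {F : EdgeSet n} {S : VSet n} (cut : CutAt false F S) where

  private
    even∈ odd∈ : Vertex n → ℕ
    even∈ v = 𝟙 (S v ∧ hasParity false v)
    odd∈  v = 𝟙 (S v ∧ hasParity true v)

  -- A non-faulty edge at an even vertex of S stays inside S.
  Link-balance : {a b : Vertex n} → Link F a b → (even∈ a + even∈ b) + 𝟙 (S a xor S b) ≤ odd∈ a + odd∈ b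
  Link-balance {a} (i , refl , ok) rewrite parity-flip a i
    with S a in Sa | S (flip a i) in Sb | parity a in pa
  ... | true  | true  | true  = ≤-refl
  ... | true  | true  | false = ≤-refl
  ... | true  | false | true  = ≤-refl
  ... | true  | false | false = contradiction (trans (sym (cut a i Sa pa Sb)) ok) λ ()
  ... | false | true  | true  = contradiction (trans (sym (cut (flip a i) i Sb pb out)) ok′) λ ()
    where
    pb : parity (flip a i) ≡ false
    pb = trans (parity-flip a i) (cong not pa)
    out : flip (flip a i) i ∉V S
    out = trans (cong S (flip-involutive a i)) Sa
    ok′ : edgeAt (flip a i) i ∉E F
    ok′ = trans (cong F (edgeAt-flip a i)) ok
  ... | false | true  | false = ≤-refl
  ... | false | false | true  = ≤-refl
  ... | false | false | false = ≤-refl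

  Hamiltonian⇒size₀<size₁ : Hamiltonian F → (∃[ v ] v ∈V S) → ProperVSet S → size₀ S < size₁ S
  Hamiltonian⇒size₀<size₁ (x , xs , unique , complete , linked) (y , y∈S) (z , z∉S) =
    subst₂ _<_ (countIn-↭ (λ v → S v ∧ hasParity false v) cycle↭) (countIn-↭ (λ v → S v ∧ hasParity true v) cycle↭)
      (half-< main)
    where
    walk = x ∷ xs ++ [ x ]
    cycle↭ : x ∷ xs ↭ allVertices n
    cycle↭ = ↭-allVertices unique complete
    on-walk : ∀ v → v ∈ walk
    on-walk v with complete v
    ... | here v≡x  = here v≡x
    ... | there v∈ = there (∈-++⁺ˡ v∈)
    crossings : 1 ≤ Σ-steps (λ a b → 𝟙 (S a xor S b)) walk
    crossings with S x in Sx
    ... | true  = Σ-steps-xor-pos S x _ (on-walk z) λ eq → contradiction (trans (sym Sx) (trans eq z∉S)) λ ()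
    ... | false = Σ-steps-xor-pos S x _ (on-walk y) λ eq → contradiction (trans (sym Sx) (trans eq y∈S)) λ ()
    A₀ = countIn (λ v → S v ∧ hasParity false v) (x ∷ xs)
    A₁ = countIn (λ v → S v ∧ hasParity true v) (x ∷ xs)
    main : (A₀ + A₀) + 1 ≤ A₁ + A₁
    main = begin
      (A₀ + A₀) + 1
        ≤⟨ +-monoʳ-≤ (A₀ + A₀) crossings ⟩
      (A₀ + A₀) + Σ-steps (λ a b → 𝟙 (S a xor S b)) walk
        ≡⟨ cong (_+ Σ-steps (λ a b → 𝟙 (S a xor S b)) walk) (Σ-steps-closed (λ v → S v ∧ hasParity false v) x xs) ⟨
      Σ-steps (λ a b → even∈ a + even∈ b) walk + Σ-steps (λ a b → 𝟙 (S a xor S b)) walk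
        ≡⟨ Σ-steps-+ (λ a b → even∈ a + even∈ b) (λ a b → 𝟙 (S a xor S b)) walk ⟨
      Σ-steps (λ a b → (even∈ a + even∈ b) + 𝟙 (S a xor S b)) walk
        ≤⟨ Σ-steps-mono linked Link-balance ⟩
      Σ-steps (λ a b → odd∈ a + odd∈ b) walk
        ≡⟨ Σ-steps-closed (λ v → S v ∧ hasParity true v) x xs ⟩
      A₁ + A₁ ∎
      where open ≤-Reasoning

-- Removing a single fault

EvenExit : VSet n → Edge n → Set
EvenExit {n} S e = Σ[ x ∈ Vertex n ] Σ[ j ∈ Fin n ] (x ∈V S × parity x ≡ false × flip x j ∉V S × edgeAt x j ≡ e)

EvenExit-edgeAt : {S : VSet n} {x : Vertex n} {j : Fin n} → EvenExit S (edgeAt x j) →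
                  (parity x ≡ false × x ∈V S × flip x j ∉V S) ⊎ (parity (flip x j) ≡ false × flip x j ∈V S × x ∉V S)
EvenExit-edgeAt {S = S} {x} {j} (y , k , y∈S , py , fy∉S , eq) with edgeAt-injective y x k j eq
... | refl , inj₁ refl = inj₁ (py , y∈S , fy∉S)
... | refl , inj₂ refl =
  inj₂ (trans (cong parity (flip-involutive y k)) py , trans (cong S (flip-involutive y k)) y∈S , fy∉S)

¬EvenExit-edgeAt : {S : VSet n} {x : Vertex n} {j : Fin n} → parity x ≡ false → x ∉V S → ¬ EvenExit S (edgeAt x j)
¬EvenExit-edgeAt {x = x} {j} px x∉S exit with EvenExit-edgeAt exit
... | inj₁ (_ , x∈S , _) = true≢false (trans (sym x∈S) x∉S)
... | inj₂ (pfx , _ , _) = parity-flip-≢ x j (trans px (sym pfx))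

CutAt-E : {F : EdgeSet n} {S : VSet n} {e : Edge n} → CutAt false F S → ¬ EvenExit S e → CutAt false (F -E e) S
CutAt-E {F = F} {e = e} cut ¬exit x j x∈S px fx∉S =
  ∈-E {F = F} {e} (cut x j x∈S px fx∉S) λ eq → ¬exit (x , j , x∈S , px , fx∉S , eq)

fault-is-EvenExit : {F : EdgeSet n} {S : VSet n} → Minimal F → CutAt false F S → (∃[ v ] v ∈V S) → ProperVSet S →
                    size₀ S ≥ size₁ S → {e : Edge n} → e ∈E F → ¬ ¬ EvenExit S e
fault-is-EvenExit {F = F} {S} min cut inhabited proper even≥odd {e} e∈F ¬exit =
  <⇒≱ (Hamiltonian⇒size₀<size₁ {F = F -E e} (CutAt-E {F = F} {S} cut ¬exit) (min (F -E e) (-E-⊊ e∈F))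
         inhabited proper)
      even≥odd

internal-fault⇒¬Minimal : {F : EdgeSet n} {T : VSet n} → ProperVSet T → size₀ T ≥ size₁ T → CutAt false F T →
                          {u : Vertex n} {i : Fin n} → u ∈V T → flip u i ∈V T → edgeAt u i ∈E F → ¬ Minimal F
internal-fault⇒¬Minimal proper even≥odd cut {u} u∈T fu∈T e∈F min =
  fault-is-EvenExit min cut (u , u∈T) proper even≥odd e∈F λ exit → case EvenExit-edgeAt exit of λ
    { (inj₁ (_ , _ , fu∉T)) → true≢false (trans (sym fu∈T) fu∉T)
    ; (inj₂ (_ , _ , u∉T))  → true≢false (trans (sym u∈T) u∉T) }

CutAt-∖-exit : {F : EdgeSet n} {S : VSet n} {p : Vertex n} {i : Fin n} → CutAt false F S →
               parity p ≡ false → flip p i ∉V S → CutAt false (F -E edgeAt p i) (S ∖ ｛ p ｝)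
CutAt-∖-exit {F = F} {S} {p} {i} cut pp fp∉S x j x∈S′ px fx∉S′ = ∈-E {F = F} {edgeAt p i} (cut x j x∈S px fx∉S) edge≢
  where
  x∈S = proj₁ (∈-∖⁻ S ｛ p ｝ x∈S′)
  x≢p : x ≢ p
  x≢p refl = true≢false (trans (sym (∈-｛｝ x)) (proj₂ (∈-∖⁻ S ｛ p ｝ x∈S′)))
  fx∉S : flip x j ∉V S
  fx∉S with ∉-∖⁻ S ｛ p ｝ fx∉S′
  ... | inj₁ fx∉S = fx∉S
  ... | inj₂ fx∈p = ⊥-elim (parity-flip-≢ x j (trans px (sym (trans (cong parity (∈-｛｝⁻ {v = flip x j} {p} fx∈p)) pp))))
  edge≢ : edgeAt x j ≢ edgeAt p i
  edge≢ eq with edgeAt-injective x p j i eq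
  ... | refl , inj₁ p≡x  = x≢p (sym p≡x)
  ... | refl , inj₂ refl = true≢false (trans (sym x∈S) (trans (cong S (sym (flip-involutive x j))) fp∉S))

CutAt-∪-exit : {F : EdgeSet n} {S : VSet n} {p : Vertex n} {i : Fin n} → CutAt false F S →
               p ∈V S → parity p ≡ false → flip p i ∉V S → CutAt false (F -E edgeAt p i) (S ∪ ｛ flip p i ｝)
CutAt-∪-exit {F = F} {S} {p} {i} cut p∈S pp fp∉S x j x∈S′ px fx∉S′ = ∈-E {F = F} {edgeAt p i} (cut x j x∈S px fx∉S) edge≢
  where
  fx∉S = proj₁ (∉-∪⁻ S ｛ flip p i ｝ fx∉S′)
  fx∉fp = proj₂ (∉-∪⁻ S ｛ flip p i ｝ fx∉S′)
  x∈S : x ∈V S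
  x∈S with ∈-∪⁻ S ｛ flip p i ｝ x∈S′
  ... | inj₁ x∈S  = x∈S
  ... | inj₂ x∈fp = ⊥-elim (parity-flip-≢ p i (trans pp (sym (trans (cong parity (sym (∈-｛｝⁻ {v = x} x∈fp))) px))))
  edge≢ : edgeAt x j ≢ edgeAt p i
  edge≢ eq with edgeAt-injective x p j i eq
  ... | refl , inj₁ refl = true≢false (trans (sym (∈-｛｝ (flip p i))) fx∉fp)
  ... | refl , inj₂ refl = true≢false (trans (sym p∈S) fx∉S)

ClosedIn : VSet n → VSet n → Set
ClosedIn T X = ∀ x j → x ∈V X → flip x j ∈V T → flip x j ∈V X

Star-∈ : {T : VSet n} {u v : Vertex n} → Star (AdjIn T) u v → u ∈V T → v ∈V T
Star-∈ ε          u∈T = u∈T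
Star-∈ (uw ◅ wv) _   = Star-∈ wv (proj₁ (proj₂ uw))

Star-avoiding : {T X : VSet n} {a b u v : Vertex n} → X ⊆V T → a ∉V X ⊎ b ∉V X →
                Star (AdjIn X) u v → Star (AdjInAvoiding T a b) u v
Star-avoiding {T = T} {X} {a} {b} X⊆T outside = Star-map step
  where
  both-inside : a ∈V X → b ∈V X → ⊥
  both-inside a∈X b∈X = case outside of λ
    { (inj₁ a∉X) → true≢false (trans (sym a∈X) a∉X)
    ; (inj₂ b∉X) → true≢false (trans (sym b∈X) b∉X) }
  step : ∀ {u v} → AdjIn X u v → AdjInAvoiding T a b u v
  step {u} {v} (u∈X , v∈X , adj) = (X⊆T u u∈X , X⊆T v v∈X , adj) , λ
    { (inj₁ (refl , refl)) → both-inside u∈X v∈X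
    ; (inj₂ (refl , refl)) → both-inside v∈X u∈X }

bridge-only : {T A B : VSet n} → Partition T A B → Connected A → Connected B →
              {a : Vertex n} {i : Fin n} → a ∈V A → flip a i ∈V B → EveryPathUses T a (flip a i) →
              ∀ x j → x ∈V A → flip x j ∈V B → edgeAt x j ≡ edgeAt a i
bridge-only {T = T} {A} {B} part A-connected B-connected {a} {i} a∈A b∈B every x j x∈A fx∈B
  with edgeAt x j ≟E edgeAt a i
... | yes same = same
... | no other = ⊥-elim (every
  (Star-avoiding A⊆T (inj₂ (∉A b∈B)) (A-connected a x a∈A x∈A) ◅◅
   ((A⊆T x x∈A , B⊆T (flip x j) fx∈B , j , refl) , not-bridge) ◅
   Star-avoiding B⊆T (inj₁ (∉B a∈A)) (B-connected (flip x j) (flip a i) fx∈B b∈B)))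
  where
  A⊆T = proj₁ (⊆-Partition {A = A} {B} part)
  B⊆T = proj₂ (⊆-Partition {A = A} {B} part)
  ∉B : ∀ {v} → v ∈V A → v ∉V B
  ∉B = Partition-∉ {A = A} {B} part
  ∉A : ∀ {v} → v ∈V B → v ∉V A
  ∉A = Partition-∉ {A = B} {A} (Partition-comm {A = A} {B} part)
  not-bridge : ¬ ((x ≡ a × flip x j ≡ flip a i) ⊎ (x ≡ flip a i × flip x j ≡ a))
  not-bridge (inj₁ (refl , fx≡fa)) with flip-injectiveʳ x fx≡fa
  ... | refl = other refl
  not-bridge (inj₂ (refl , _)) = true≢false (trans (sym x∈A) (∉A b∈B))

¬¬-All : {P : A → Set} → (∀ x → ¬ ¬ P x) → (xs : List A) → ¬ ¬ All P xs
¬¬-All ¬¬P []       k = k []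
¬¬-All ¬¬P (x ∷ xs) k = ¬¬P x λ px → ¬¬-All ¬¬P xs λ pxs → k (px ∷ pxs)

¬¬-∀-Vertex : {P : Vertex n → Set} → (∀ v → ¬ ¬ P v) → ¬ ¬ (∀ v → P v)
¬¬-∀-Vertex ¬¬P k = ¬¬-All ¬¬P (allVertices _) λ all → k λ v → lookup all (∈-allVertices v)

module Component {T : VSet n} {u : Vertex n} (reach? : ∀ w → Dec (Star (AdjIn T) u w)) (u∈T : u ∈V T) where

  component : VSet n
  component w = does (reach? w)

  ∈-component⁺ : {w : Vertex n} → Star (AdjIn T) u w → w ∈V component
  ∈-component⁺ {w} r with reach? w
  ... | yes _ = refl
  ... | no ¬r = contradiction r ¬r

  ∉-component⁺ : {w : Vertex n} → ¬ Star (AdjIn T) u w → w ∉V component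
  ∉-component⁺ {w} ¬r with reach? w
  ... | yes r = contradiction r ¬r
  ... | no _  = refl

  ∈-component⁻ : {w : Vertex n} → w ∈V component → Star (AdjIn T) u w
  ∈-component⁻ {w} w∈ with reach? w
  ... | yes r = r

  component⊆T : component ⊆V T
  component⊆T w w∈ = Star-∈ (∈-component⁻ w∈) u∈T

  component-partition : Partition T component (T ∖ component)
  component-partition = Partition-comm {A = T ∖ component} {component} (Partition-∖ {S = T} {component} component⊆T)

  component-closed : ClosedIn T component
  component-closed x j x∈ fx∈T =
    ∈-component⁺ (∈-component⁻ x∈ ◅◅ ((component⊆T x x∈ , fx∈T , j , refl) ◅ ε))

  rest-closed : ClosedIn T (T ∖ component)
  rest-closed x j x∈ fx∈T = ∈-∖⁺ T component fx∈T fx∉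
    where
    x∈T = proj₁ (∈-∖⁻ T component x∈)
    fx∉ : flip x j ∉V component
    fx∉ with component (flip x j) in fx∈
    ... | false = refl
    ... | true  = contradiction
      (∈-component⁺ (∈-component⁻ fx∈ ◅◅ ((fx∈T , x∈T , j , sym (flip-involutive x j)) ◅ ε)))
      (λ x∈C → true≢false (trans (sym x∈C) (proj₂ (∈-∖⁻ T component x∈))))

-- Pendant vertices

third-vertex : {T : VSet n} {p q : Vertex n} → 3 ≤ size T → p ∈V T → q ∈V T → q ≢ p →
               ∃[ r ] r ∈V (T ∖ ｛ p ｝ ∖ ｛ q ｝)
third-vertex {T = T} {p} {q} 3≤|T| p∈T q∈T q≢p = size-pos (T ∖ ｛ p ｝ ∖ ｛ q ｝) (≤-pred (≤-pred (subst (3 ≤_) |T| 3≤|T|)))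
  where
  s = size (T ∖ ｛ p ｝ ∖ ｛ q ｝)
  |T| : size T ≡ suc (suc s)
  |T| = begin
    size T                              ≡⟨ size-∖｛｝ T p∈T ⟩
    size (T ∖ ｛ p ｝) + 1                ≡⟨ cong (_+ 1) (size-∖｛｝ (T ∖ ｛ p ｝) (∈-∖⁺ T ｛ p ｝ q∈T (∉-｛｝ q≢p))) ⟩
    (s + 1) + 1                         ≡⟨ trans (+-comm (s + 1) 1) (cong suc (+-comm s 1)) ⟩
    suc (suc s)                         ∎
    where open ≡-Reasoning

pendant⇒DisconnectedHalfway : {F : EdgeSet n} {T : VSet n} → ProperVSet T → 3 ≤ size T → size₀ T ≥ size₁ T →
                              CutAt false F T → HasPendant T → ∃[ T′ ] (T′ ⊊V T × DisconnectedHalfway F T′)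
pendant⇒DisconnectedHalfway {n} {F} {T} (z , z∉T) 3≤|T| even≥odd cut (p , p∈T , degree≡1)
  with countIn-one (λ i → T (flip p i)) (allFin n) degree≡1
... | i , q∈T , unique-neighbour with parity p in pp
...   | false = T′ , (T′⊆T , r , r∈T , r∉T′) , (p , p∈T′) , (z , ⊆⇒∉ T′⊆T z∉T) , inj₁ (even≥odd′ , cut′)
  where
  q = flip p i
  T′ = ｛ p ｝ ∪ ｛ q ｝
  T′⊆T : T′ ⊆V T
  T′⊆T v v∈T′ with ∈-∪⁻ ｛ p ｝ ｛ q ｝ {v} v∈T′
  ... | inj₁ v∈p = subst (_∈V T) (sym (∈-｛｝⁻ {v = v} {p} v∈p)) p∈T
  ... | inj₂ v∈q = subst (_∈V T) (sym (∈-｛｝⁻ {v = v} {q} v∈q)) q∈T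
  r = proj₁ (third-vertex 3≤|T| p∈T q∈T (flip-≢ p i))
  r∈T∖p∖q = proj₂ (third-vertex 3≤|T| p∈T q∈T (flip-≢ p i))
  r∈T∖p = proj₁ (∈-∖⁻ (T ∖ ｛ p ｝) ｛ q ｝ r∈T∖p∖q)
  r∈T = proj₁ (∈-∖⁻ T ｛ p ｝ r∈T∖p)
  r∉T′ : r ∉V T′
  r∉T′ = ∉-∪⁺ ｛ p ｝ ｛ q ｝ {r} (proj₂ (∈-∖⁻ T ｛ p ｝ r∈T∖p)) (proj₂ (∈-∖⁻ (T ∖ ｛ p ｝) ｛ q ｝ r∈T∖p∖q))
  p∈T′ : p ∈V T′
  p∈T′ = ∈-∪⁺ˡ ｛ p ｝ ｛ q ｝ {p} (∈-｛｝ p)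
  pq : parity q ≡ true
  pq = trans (parity-flip p i) (cong not pp)
  q∉p : q ∉V ｛ p ｝
  q∉p = ∉-｛｝ (flip-≢ p i)
  even≥odd′ : size₀ T′ ≥ size₁ T′
  even≥odd′ = ≤-reflexive (begin
    size₁ T′             ≡⟨ proj₁ (sizeP-∪｛｝ ｛ p ｝ q∉p pq) ⟩
    size₁ ｛ p ｝ + 1      ≡⟨ cong (_+ 1) (proj₂ (sizeP-｛｝ false p pp)) ⟩
    1                    ≡⟨ proj₁ (sizeP-｛｝ false p pp) ⟨
    size₀ ｛ p ｝          ≡⟨ proj₂ (sizeP-∪｛｝ ｛ p ｝ q∉p pq) ⟨
    size₀ T′             ∎)
    where open ≡-Reasoning
  cut′ : CutAt false F T′
  cut′ x j x∈T′ px fx∉T′ with ∈-∪⁻ ｛ p ｝ ｛ q ｝ {x} x∈T′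
  ... | inj₂ x∈q = ⊥-elim (true≢false (trans (sym pq) (trans (cong parity (sym (∈-｛｝⁻ {v = x} {q} x∈q))) px)))
  ... | inj₁ x∈p with ∈-｛｝⁻ {v = x} {p} x∈p
  ...   | refl = cut p j p∈T pp fp∉T
    where
    fp∉T : flip p j ∉V T
    fp∉T with T (flip p j) in fp∈T
    ... | false = refl
    ... | true with unique-neighbour j (∈-allFin j) fp∈T
    ...   | refl = contradiction (trans (sym (∈-｛｝ q)) (proj₂ (∉-∪⁻ ｛ p ｝ ｛ q ｝ {q} fx∉T′))) λ ()
...   | true = T′ , (T′⊆T , p , p∈T , p∉T′) , (r , r∈T′) , (z , ⊆⇒∉ T′⊆T z∉T) , inj₁ (even≥odd′ , cut′)
  where
  q = flip p i
  T′ = T ∖ ｛ p ｝ ∖ ｛ q ｝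
  T′⊆T : T′ ⊆V T
  T′⊆T v v∈T′ = proj₁ (∈-∖⁻ T ｛ p ｝ (proj₁ (∈-∖⁻ (T ∖ ｛ p ｝) ｛ q ｝ v∈T′)))
  p∉T′ : p ∉V T′
  p∉T′ rewrite ∈-｛｝ p | ∧-zeroʳ (T p) = refl
  r∈T′ = proj₂ (third-vertex 3≤|T| p∈T q∈T (flip-≢ p i))
  r = proj₁ (third-vertex 3≤|T| p∈T q∈T (flip-≢ p i))
  pq : parity q ≡ false
  pq = trans (parity-flip p i) (cong not pp)
  q∈T∖p = ∈-∖⁺ T ｛ p ｝ q∈T (∉-｛｝ (flip-≢ p i))
  even≥odd′ : size₀ T′ ≥ size₁ T′
  even≥odd′ = +-cancelʳ-≤ 1 (size₁ T′) (size₀ T′) (subst₂ _≤_ odd-sizes even-sizes even≥odd)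
    where
    open ≡-Reasoning
    odd-sizes : size₁ T ≡ size₁ T′ + 1
    odd-sizes = begin
      size₁ T               ≡⟨ proj₁ (sizeP-∖｛｝ T p∈T pp) ⟩
      size₁ (T ∖ ｛ p ｝) + 1 ≡⟨ cong (_+ 1) (proj₂ (sizeP-∖｛｝ (T ∖ ｛ p ｝) q∈T∖p pq)) ⟩
      size₁ T′ + 1          ∎
    even-sizes : size₀ T ≡ size₀ T′ + 1
    even-sizes = begin
      size₀ T               ≡⟨ proj₂ (sizeP-∖｛｝ T p∈T pp) ⟩
      size₀ (T ∖ ｛ p ｝)     ≡⟨ proj₁ (sizeP-∖｛｝ (T ∖ ｛ p ｝) q∈T∖p pq) ⟩
      size₀ T′ + 1          ∎
  cut′ : CutAt false F T′
  cut′ x j x∈T′ px fx∉T′ with ∉-∖⁻ (T ∖ ｛ p ｝) ｛ q ｝ fx∉T′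
  ... | inj₂ fx∈q = ⊥-elim (parity-flip-≢ x j (trans px (sym (trans (cong parity (∈-｛｝⁻ {v = flip x j} {q} fx∈q)) pq))))
  ... | inj₁ fx∉T∖p with ∉-∖⁻ T ｛ p ｝ fx∉T∖p
  ...   | inj₁ fx∉T = cut x j (T′⊆T x x∈T′) px fx∉T
  ...   | inj₂ fx∈p = ⊥-elim (true≢false (trans (sym (subst (_∈V ｛ q ｝) (sym x≡q) (∈-｛｝ q))) x∉q))
    where
    x∉q = proj₂ (∈-∖⁻ (T ∖ ｛ p ｝) ｛ q ｝ x∈T′)
    fp≡x : flip p j ≡ x
    fp≡x = trans (cong (λ v → flip v j) (sym (∈-｛｝⁻ {v = flip x j} {p} fx∈p))) (flip-involutive x j)
    x≡q : x ≡ q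
    x≡q = trans (sym fp≡x) (cong (flip p) (unique-neighbour j (∈-allFin j) (subst (_∈V T) (sym fp≡x) (T′⊆T x x∈T′))))

direction : 3 ≤ n → Fin n
direction (s≤s _) = zero

another : 3 ≤ n → Fin n → Fin n
another (s≤s (s≤s _)) zero    = suc zero
another (s≤s (s≤s _)) (suc _) = zero

another-≢ : (3≤n : 3 ≤ n) (i : Fin n) → another 3≤n i ≢ i
another-≢ (s≤s (s≤s _)) zero    ()
another-≢ (s≤s (s≤s _)) (suc _) ()

module Minimality {n : ℕ} (3≤n : 3 ≤ n) where

  -- Any Hamiltonian cycle of Q_n will do, since S is cut by every fault set.
  noEvenExit⇒size₀<size₁ : {S : VSet n} → (∀ e → ¬ EvenExit S e) → (∃[ v ] v ∈V S) → ProperVSet S →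
                           size₀ S < size₁ S
  noEvenExit⇒size₀<size₁ noExit = Hamiltonian⇒size₀<size₁ {F = ｛ edgeAt u i ｝E} cut (Hamiltonian-｛｝E 3≤n u i)
    where
    u = Vec.replicate n false
    i = direction 3≤n
    cut : CutAt false ｛ edgeAt u i ｝E _
    cut x j x∈S px fx∉S = ⊥-elim (noExit _ (x , j , x∈S , px , fx∉S , refl))

  -- F without the exit edge p–p′ still cuts S ∖ {p} and S ∪ {p′}; unless S = {p}, the first is
  -- nonempty, and otherwise the second is proper.  Both keep |·|₀ ≥ |·|₁.
  exit⇒¬Minimal : {F : EdgeSet n} {S : VSet n} → CutAt false F S → size₀ S > size₁ S →
                  {p : Vertex n} {i : Fin n} → p ∈V S → parity p ≡ false → flip p i ∉V S → ¬ Minimal F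
  exit⇒¬Minimal {F} {S} cut gt {p} {i} p∈S pp fp∉S min = ¬¬-excluded-middle {A = ∃[ v ] (v ∈V S × v ≢ p)} λ
    { (yes (v , v∈S , v≢p)) →
        <⇒≱ (Hamiltonian⇒size₀<size₁ {F = F -E edgeAt p i} {S ∖ ｛ p ｝} (CutAt-∖-exit {F = F} cut pp fp∉S) Ham
              (v , ∈-∖⁺ S ｛ p ｝ v∈S (∉-｛｝ v≢p)) (flip p i , ∉-∖⁺ˡ S ｛ p ｝ fp∉S))
            (shrink-balance (proj₁ (sizeP-∖｛｝ S p∈S pp)) (proj₂ (sizeP-∖｛｝ S p∈S pp)))
    ; (no ¬other) →
        <⇒≱ (Hamiltonian⇒size₀<size₁ {F = F -E edgeAt p i} {S ∪ ｛ flip p i ｝} (CutAt-∪-exit {F = F} cut p∈S pp fp∉S) Ham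
              (p , ∈-∪⁺ˡ S ｛ flip p i ｝ p∈S) (z , ∉-∪⁺ S ｛ flip p i ｝ (z∉S ¬other) z∉fp))
            (grow-balance (proj₁ (sizeP-∪｛｝ S fp∉S pfp)) (proj₂ (sizeP-∪｛｝ S fp∉S pfp))) }
    where
    Ham : Hamiltonian (F -E edgeAt p i)
    Ham = min (F -E edgeAt p i) (-E-⊊ {F = F} (cut p i p∈S pp fp∉S))
    pfp : parity (flip p i) ≡ true
    pfp = trans (parity-flip p i) (cong not pp)
    z = flip p (another 3≤n i)
    z∉S : ¬ (∃[ v ] (v ∈V S × v ≢ p)) → z ∉V S
    z∉S ¬other with S z in Sz
    ... | true  = contradiction (z , Sz , flip-≢ p _) ¬other
    ... | false = refl
    z∉fp : z ∉V ｛ flip p i ｝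
    z∉fp = ∉-｛｝ λ eq → another-≢ 3≤n i (flip-injectiveʳ p eq)
    shrink-balance : {a₀ a₁ : ℕ} → size₀ S ≡ a₀ + 1 → size₁ S ≡ a₁ → a₁ ≤ a₀
    shrink-balance {a₀} e₀ refl = ≤-pred (subst (size₁ S <_) (trans e₀ (+-comm a₀ 1)) gt)
    grow-balance : {a₀ a₁ : ℕ} → a₁ ≡ size₁ S + 1 → a₀ ≡ size₀ S → a₁ ≤ a₀
    grow-balance e₁ e₀ = subst₂ _≤_ (sym (trans e₁ (+-comm (size₁ S) 1))) (sym e₀) gt

  size₀>size₁⇒¬Minimal : {F : EdgeSet n} {S : VSet n} → CutAt false F S → size₀ S > size₁ S → ¬ Minimal F
  size₀>size₁⇒¬Minimal {F} {S} cut gt min =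
    ¬¬-excluded-middle {A = ∃[ e ] EvenExit S e} λ
      { (yes (_ , p , i , p∈S , pp , fp∉S , _)) → exit⇒¬Minimal cut gt p∈S pp fp∉S min
      ; (no ¬exit) → ¬¬-excluded-middle {A = ProperVSet S} λ
        { (yes proper) → <⇒≱ (noEvenExit⇒size₀<size₁ (λ e exit → ¬exit (e , exit))
                                (sizeP-pos false S (≤-trans (s≤s z≤n) gt)) proper) (<⇒≤ gt)
        ; (no ¬proper) → <-irrefl (balanced ¬proper) gt } }
    where
    balanced : ¬ ProperVSet S → size₁ S ≡ size₀ S
    balanced ¬proper = begin
      size₁ S    ≡⟨ sizeP-full true all∈S ⟩
      size₁ (full {n}) ≡⟨ size₀-full≡size₁-full (direction 3≤n) ⟨
      size₀ (full {n}) ≡⟨ sizeP-full false all∈S ⟨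
      size₀ S    ∎
      where
      open ≡-Reasoning
      all∈S : ∀ v → v ∈V S
      all∈S v with S v in Sv
      ... | true  = refl
      ... | false = contradiction (v , Sv) ¬proper

  private
    -- Unless some fault is not an even exit of A, B has no even exit at all, so |B|₀ < |B|₁ and
    -- hence |A|₀ > |A|₁.
    closed-split⇒¬Minimal′ : {F : EdgeSet n} {T A B : VSet n} → CutAt false F T → size₀ T ≥ size₁ T →
                             Partition T A B → ClosedIn T A → ClosedIn T B → (∃[ a ] a ∈V A) → (∃[ b ] b ∈V B) →
                             size₀ A ≥ size₁ A → ¬ Minimal F
    closed-split⇒¬Minimal′ {F} {T} {A} {B} cut T-even≥odd part A-closed B-closed (a , a∈A) (b , b∈B) A-even≥odd min =
      ¬¬-excluded-middle {A = Σ[ e ∈ Edge n ] (e ∈E F × ¬ EvenExit A e)} λ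
        { (yes (e , e∈F , ¬exit)) → fault-is-EvenExit min (cut-part A⊆T A-closed) (a , a∈A) (b , ∉A b∈B) A-even≥odd e∈F ¬exit
        ; (no ¬non-exit) → size₀>size₁⇒¬Minimal (cut-part A⊆T A-closed) (A-heavier ¬non-exit) min }
      where
      A⊆T = proj₁ (⊆-Partition {A = A} {B} part)
      B⊆T = proj₂ (⊆-Partition {A = A} {B} part)
      ∉B : ∀ {v} → v ∈V A → v ∉V B
      ∉B = Partition-∉ {A = A} {B} part
      ∉A : ∀ {v} → v ∈V B → v ∉V A
      ∉A = Partition-∉ {A = B} {A} (Partition-comm {A = A} {B} part)
      leaves : {X : VSet n} → ClosedIn T X → ∀ {x} j → x ∈V X → flip x j ∉V X → flip x j ∉V T
      leaves X-closed {x} j x∈X fx∉X with T (flip x j) in fx∈T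
      ... | true  = contradiction (trans (sym (X-closed x j x∈X fx∈T)) fx∉X) λ ()
      ... | false = refl
      cut-part : {X : VSet n} → X ⊆V T → ClosedIn T X → CutAt false F X
      cut-part X⊆T X-closed x j x∈X px fx∉X = cut x j (X⊆T x x∈X) px (leaves X-closed j x∈X fx∉X)
      B-noEvenExit : ¬ (Σ[ e ∈ Edge n ] (e ∈E F × ¬ EvenExit A e)) → ∀ e → ¬ EvenExit B e
      B-noEvenExit ¬non-exit _ (x , j , x∈B , px , fx∉B , refl) =
        ¬non-exit (edgeAt x j , cut x j (B⊆T x x∈B) px (leaves B-closed j x∈B fx∉B) , ¬EvenExit-edgeAt px (∉A x∈B))
      A-heavier : ¬ (Σ[ e ∈ Edge n ] (e ∈E F × ¬ EvenExit A e)) → size₀ A > size₁ A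
      A-heavier ¬non-exit = heavier-part
        (subst₂ _≤_ (sizeP-partition {A = A} {B} part true) (sizeP-partition {A = A} {B} part false) T-even≥odd)
        (noEvenExit⇒size₀<size₁ (B-noEvenExit ¬non-exit) (b , b∈B) (a , ∉B a∈A))

  closed-split⇒¬Minimal : {F : EdgeSet n} {T A B : VSet n} → CutAt false F T → size₀ T ≥ size₁ T →
                          Partition T A B → ClosedIn T A → ClosedIn T B → (∃[ a ] a ∈V A) → (∃[ b ] b ∈V B) →
                          ¬ Minimal F
  closed-split⇒¬Minimal {A = A} {B} cut T-even≥odd part A-closed B-closed a b with size₁ A ≤? size₀ A
  ... | yes A-even≥odd = closed-split⇒¬Minimal′ cut T-even≥odd part A-closed B-closed a b A-even≥odd
  ... | no  A-even≱odd = closed-split⇒¬Minimal′ cut T-even≥odd (Partition-comm {A = A} {B} part) B-closed A-closed b a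
    (<⇒≤ (heavier-part (subst₂ _≤_ (trans (sizeP-partition {A = A} {B} part true) (+-comm (size₁ A) (size₁ B)))
                                   (trans (sizeP-partition {A = A} {B} part false) (+-comm (size₀ A) (size₀ B))) T-even≥odd)
                       (≰⇒> A-even≱odd)))

  -- Reachability in T is not decidable constructively, but for a negative goal it suffices that its
  -- decidability cannot be refuted.
  ¬Connected⇒¬Minimal : {F : EdgeSet n} {T : VSet n} → CutAt false F T → size₀ T ≥ size₁ T → ¬ Connected T → ¬ Minimal F
  ¬Connected⇒¬Minimal {F} {T} cut even≥odd ¬connected min =
    ¬¬-∀-Vertex (λ u → ¬¬-∀-Vertex λ w → ¬¬-excluded-middle {A = Star (AdjIn T) u w}) λ reach? →
    ¬¬-excluded-middle {A = Σ[ u ∈ Vertex n ] Σ[ v ∈ Vertex n ] (u ∈V T × v ∈V T × ¬ Star (AdjIn T) u v)} λ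
      { (yes (u , v , u∈T , v∈T , ¬uv)) →
          let open Component (reach? u) u∈T in
          closed-split⇒¬Minimal cut even≥odd component-partition component-closed rest-closed
            (u , ∈-component⁺ ε) (v , ∈-∖⁺ T component v∈T (∉-component⁺ ¬uv)) min
      ; (no ¬disconnected) → ¬connected λ u v u∈T v∈T → case reach? u v of λ
          { (yes uv) → uv
          ; (no ¬uv) → ⊥-elim (¬disconnected (u , v , u∈T , v∈T , ¬uv)) } }


  -- Unless some fault is not an even exit of B, Q_n minus the bridge alone cuts A.
  bridged-split⇒¬Minimal : {F : EdgeSet n} {T A B : VSet n} → CutAt false F T → Partition T A B →
                           size₀ A ≡ size₁ A → size₀ B ≡ size₁ B →
                           {a : Vertex n} {i : Fin n} → a ∈V A → parity a ≡ false → flip a i ∈V B →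
                           (∀ x j → x ∈V A → flip x j ∈V B → edgeAt x j ≡ edgeAt a i) → ¬ Minimal F
  bridged-split⇒¬Minimal {F} {T} {A} {B} cut part A-balanced B-balanced {a} {i} a∈A pa b∈B only min =
    ¬¬-excluded-middle {A = Σ[ e ∈ Edge n ] (e ∈E F × ¬ EvenExit B e)} λ
      { (yes (e , e∈F , ¬exit)) →
          fault-is-EvenExit min cutB (flip a i , b∈B) (a , ∉B a∈A) (≤-reflexive (sym B-balanced)) e∈F ¬exit
      ; (no ¬non-exit) →
          <⇒≱ (Hamiltonian⇒size₀<size₁ {F = ｛ edgeAt a i ｝E} {A} (cutA ¬non-exit) (Hamiltonian-｛｝E 3≤n a i)
                 (a , a∈A) (flip a i , ∉A b∈B))
              (≤-reflexive (sym A-balanced)) }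
    where
    A⊆T = proj₁ (⊆-Partition {A = A} {B} part)
    B⊆T = proj₂ (⊆-Partition {A = A} {B} part)
    ∉B : ∀ {v} → v ∈V A → v ∉V B
    ∉B = Partition-∉ {A = A} {B} part
    ∉A : ∀ {v} → v ∈V B → v ∉V A
    ∉A = Partition-∉ {A = B} {A} (Partition-comm {A = A} {B} part)
    cutB : CutAt false F B
    cutB x j x∈B px fx∉B with T (flip x j) in fx∈T
    ... | false = cut x j (B⊆T x x∈B) px fx∈T
    ... | true  with only (flip x j) j fx∈A (subst (_∈V B) (sym (flip-involutive x j)) x∈B)
      where fx∈A = Partition-∈ {A = B} {A} (Partition-comm {A = A} {B} part) fx∈T fx∉B
    ...   | same with edgeAt-injective x a j i (trans (sym (edgeAt-flip x j)) same)
    ...     | refl , inj₁ refl = ⊥-elim (true≢false (trans (sym x∈B) (∉B a∈A)))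
    ...     | refl , inj₂ refl = ⊥-elim (parity-flip-≢ x j (trans px (sym pa)))
    cutA : ¬ (Σ[ e ∈ Edge n ] (e ∈E F × ¬ EvenExit B e)) → CutAt false ｛ edgeAt a i ｝E A
    cutA ¬non-exit x j x∈A px fx∉A with T (flip x j) in fx∈T
    ... | true  = subst (_∈E ｛ edgeAt a i ｝E) (sym (only x j x∈A fx∈B)) (∈-｛｝E (edgeAt a i))
      where fx∈B = Partition-∈ {A = A} {B} part fx∈T fx∉A
    ... | false = ⊥-elim (¬non-exit (edgeAt x j , cut x j (A⊆T x x∈A) px fx∈T , ¬EvenExit-edgeAt px (∉B x∈A)))

  bridge⇒¬Minimal : {F : EdgeSet n} {T : VSet n} → CutAt false F T →
                    (T₁ T₂ : VSet n) → Partition T T₁ T₂ → Connected T₁ → Connected T₂ →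
                    size₀ T₁ ≡ size₁ T₁ → size₀ T₂ ≡ size₁ T₂ →
                    (v₁ v₂ : Vertex n) → v₁ ∈V T₁ → v₂ ∈V T₂ → Adjacent v₁ v₂ →
                    EveryPathUses T v₁ v₂ → ¬ Minimal F
  bridge⇒¬Minimal cut T₁ T₂ part T₁-connected T₂-connected T₁-balanced T₂-balanced v₁ _ v₁∈T₁ v₂∈T₂ (i , refl) every
    with parity v₁ in pv₁
  ... | false = bridged-split⇒¬Minimal cut part T₁-balanced T₂-balanced v₁∈T₁ pv₁ v₂∈T₂ only
    where only = bridge-only {A = T₁} {T₂} part T₁-connected T₂-connected v₁∈T₁ v₂∈T₂ every
  ... | true  = bridged-split⇒¬Minimal cut (Partition-comm {A = T₁} {T₂} part) T₂-balanced T₁-balanced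
                  v₂∈T₂ pv₂ (subst (_∈V T₁) (sym (flip-involutive v₁ i)) v₁∈T₁) only′
    where
    only = bridge-only {A = T₁} {T₂} part T₁-connected T₂-connected v₁∈T₁ v₂∈T₂ every
    pv₂ : parity (flip v₁ i) ≡ false
    pv₂ = trans (parity-flip v₁ i) (cong not pv₁)
    only′ : ∀ x j → x ∈V T₂ → flip x j ∈V T₁ → edgeAt x j ≡ edgeAt (flip v₁ i) i
    only′ x j x∈T₂ fx∈T₁ = begin
      edgeAt x j                   ≡⟨ edgeAt-flip x j ⟨
      edgeAt (flip x j) j          ≡⟨ only (flip x j) j fx∈T₁ (subst (_∈V T₂) (sym (flip-involutive x j)) x∈T₂) ⟩
      edgeAt v₁ i                  ≡⟨ edgeAt-flip v₁ i ⟨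
      edgeAt (flip v₁ i) i         ∎
      where open ≡-Reasoning

lemma4 : (n : ℕ) → 3 ≤ n → (F : EdgeSet n) → (T : VSet n) →
    ProperVSet T → 3 ≤ size T → size₀ T ≥ size₁ T → CutAt false F T →
    -- (1)
    ((∃[ u ] Σ[ i ∈ Fin n ] (u ∈V T × flip u i ∈V T × edgeAt u i ∈E F)) → ¬ Minimal F)
    -- (2)
    × (size₀ T > size₁ T → ¬ Minimal F)
    -- (3)
    × (¬ Connected T → ¬ Minimal F)
    -- (4)
    × (HasPendant T → ¬ Minimal F ⊎ (∃[ T' ] (T' ⊊V T × DisconnectedHalfway F T')))
    -- (5)
    × ((T₁ T₂ : VSet n) → Partition T T₁ T₂ → Connected T₁ → Connected T₂ →
       size₀ T₁ ≡ size₁ T₁ → size₀ T₂ ≡ size₁ T₂ →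
       (v₁ v₂ : Vertex n) → v₁ ∈V T₁ → v₂ ∈V T₂ → Adjacent v₁ v₂ →
       EveryPathUses T v₁ v₂ → ¬ Minimal F)
lemma4 n 3≤n F T proper 3≤|T| even≥odd cut =
    (λ (_ , _ , u∈T , fu∈T , e∈F) → internal-fault⇒¬Minimal {F = F} proper even≥odd cut u∈T fu∈T e∈F)
  , size₀>size₁⇒¬Minimal cut
  , ¬Connected⇒¬Minimal cut even≥odd
  , (λ pendant → inj₂ (pendant⇒DisconnectedHalfway {F = F} proper 3≤|T| even≥odd cut pendant))
  , bridge⇒¬Minimal cut
  where open Minimality 3≤n
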